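{- Let $G_1=(V_1,E_1)$ and $G_2=(V_2,E_2)$ be trivalent $2$-edge-connected graphs. Let $(a_1,b_1)\in E_1$ and $(a_2,b_2)\in E_2$. Let $G$ be the graph on $V_1\sqcup V_2$ obtained from the disjoint union $G_1\sqcup G_2$ by deleting these two edges and adding the edges $(a_1,a_2)$ and $(b_1,b_2)$. Then $M_G=M_{G_1}\oplus M_{G_2}$ as matroids on $V_1\sqcup V_2$.
   Context: Graphs are finite and undirected and may have parallel edges; trivalent means every vertex has degree $3$. For a graph $H=(V,E)$, $r^*$ is the rank function of the bond (cographic) matroid of $H$, the dual of the cycle matroid. For $A\subseteq V$, $\delta(A)$ is the set of edges incident to at least one vertex of $A$. The graph curve matroid $M_H$ is the matroid on $V$ whose circuits are the non-empty subsets $A\subseteq V$ that are inclusion-minimal among non-empty subsets satisfying $r^*(\delta(A))\le|A|$. $\oplus$ denotes the direct sum of matroids. -}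

module Defs where

open import Data.Nat using (ℕ; zero; suc; _+_; _∸_; _≤_)
open import Data.Fin using (Fin; _≟_; _<?_; _↑ˡ_; _↑ʳ_; splitAt)
open import Data.Fin.Subset using (Subset; ∣_∣; Nonempty; _⊆_; ⊥; ⊤; ∁; ⁅_⁆)
open import Data.Vec using (Vec; lookup; tabulate; _++_)
open import Data.Bool using (Bool; true; false; _∧_; _∨_; not; if_then_else_)
open import Data.Product using (Σ; _×_; _,_; proj₁; proj₂)
open import Data.Sum using (_⊎_; inj₁; inj₂)
open import Relation.Nullary.Decidable using (⌊_⌋)
open import Relation.Binary.PropositionalEquality using (_≡_)

-- A finite undirected multigraph: vertices Fin nV, edges Fin nE,
-- each edge has a (unordered, recorded as a pair) set of endpoints.
record Graph : Set where
  field
    nV : ℕ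
    nE : ℕ
    ends : Fin nE → Fin nV × Fin nV
open Graph public

count : ∀ {k} → (Fin k → Bool) → ℕ
count f = ∣ tabulate f ∣

anyF : ∀ {k} → (Fin k → Bool) → Bool
anyF {zero} f = false
anyF {suc k} f = f Fin.zero ∨ anyF (λ i → f (Fin.suc i))
  where import Data.Fin as Fin

_==_ : ∀ {k} → Fin k → Fin k → Bool
u == v = ⌊ u ≟ v ⌋

module _ (H : Graph) where
  private
    p₁ p₂ : Fin (nE H) → Fin (nV H)
    p₁ e = proj₁ (ends H e)
    p₂ e = proj₂ (ends H e)

  -- degree (a loop counts twice)
  degree : Fin (nV H) → ℕ
  degree v = count (λ e → p₁ e == v) + count (λ e → p₂ e == v)

  Trivalent : Set
  Trivalent = ∀ v → degree v ≡ 3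

  EdgeBetween : Fin (nE H) → Fin (nV H) → Fin (nV H) → Set
  EdgeBetween e a b = (ends H e ≡ (a , b)) ⊎ (ends H e ≡ (b , a))

  reach : Subset (nE H) → ℕ → Fin (nV H) → Fin (nV H) → Bool
  reach Y zero u v = u == v
  reach Y (suc k) u v = reach Y k u v ∨ anyF (λ e → lookup Y e ∧
      ((reach Y k u (p₁ e) ∧ (p₂ e == v)) ∨ (reach Y k u (p₂ e) ∧ (p₁ e == v))))

  connectedIn : Subset (nE H) → Fin (nV H) → Fin (nV H) → Bool
  connectedIn Y = reach Y (nV H)

  -- number of connected components of (V, Y): count the least vertex of each component
  components : Subset (nE H) → ℕ
  components Y = count (λ v → not (anyF (λ u → ⌊ u <? v ⌋ ∧ connectedIn Y u v)))

  rankCycle : Subset (nE H) → ℕ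
  rankCycle Y = nV H ∸ components Y

  -- rank function of the bond matroid (dual): r*(X) = |X| + r(E ∖ X) - r(E)
  rankBond : Subset (nE H) → ℕ
  rankBond X = (∣ X ∣ + rankCycle (∁ X)) ∸ rankCycle ⊤

  δ : Subset (nV H) → Subset (nE H)
  δ A = tabulate (λ e → lookup A (p₁ e) ∨ lookup A (p₂ e))

  Dependent : Subset (nV H) → Set
  Dependent A = rankBond (δ A) ≤ ∣ A ∣

  -- circuits of the graph curve matroid M_H
  IsCircuit : Subset (nV H) → Set
  IsCircuit A = Nonempty A × Dependent A
    × (∀ B → Nonempty B → B ⊆ A → Dependent B → B ≡ A)

  Connected : Set
  Connected = ∀ u v → connectedIn ⊤ u v ≡ true

  TwoEdgeConnected : Set
  TwoEdgeConnected = Connected × (∀ e u v → connectedIn (∁ ⁅ e ⁆) u v ≡ true)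

-- Direct sum of matroids on Fin n₁ and Fin n₂, as a matroid on Fin (n₁ + n₂)
-- (V₁ embedded by inject+, V₂ by raise), given by its circuits:
-- circuits of the first summand together with circuits of the second.
DirectSumCircuit : ∀ {n₁ n₂} → (Subset n₁ → Set) → (Subset n₂ → Set) → Subset (n₁ + n₂) → Set
DirectSumCircuit {n₁} {n₂} C₁ C₂ A =
  (Σ (Subset n₁) λ C → C₁ C × A ≡ C ++ ⊥) ⊎ (Σ (Subset n₂) λ D → C₂ D × A ≡ ⊥ ++ D)

-- The graph G: disjoint union of G₁, G₂ (vertices of G₁ first), with edge e₁ of G₁
-- replaced by (a₁,a₂) and edge e₂ of G₂ replaced by (b₁,b₂).
glue : (G₁ G₂ : Graph) → Fin (nE G₁) → Fin (nE G₂) →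
       Fin (nV G₁) → Fin (nV G₁) → Fin (nV G₂) → Fin (nV G₂) → Graph
glue G₁ G₂ e₁ e₂ a₁ b₁ a₂ b₂ = record
  { nV = nV G₁ + nV G₂
  ; nE = nE G₁ + nE G₂
  ; ends = λ e → f (splitAt (nE G₁) e)
  }
  where
  L : Fin (nV G₁) → Fin (nV G₁ + nV G₂)
  L i = i ↑ˡ nV G₂
  R : Fin (nV G₂) → Fin (nV G₁ + nV G₂)
  R i = nV G₁ ↑ʳ i
  f : Fin (nE G₁) ⊎ Fin (nE G₂) → Fin (nV G₁ + nV G₂) × Fin (nV G₁ + nV G₂)
  f (inj₁ e) = if e == e₁ then (L a₁ , R a₂)
               else (L (proj₁ (ends G₁ e)) , L (proj₂ (ends G₁ e)))
  f (inj₂ e) = if e == e₂ then (L b₁ , R b₂)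
               else (R (proj₁ (ends G₂ e)) , R (proj₂ (ends G₂ e)))

-- For connected H, r*(δA) = |δA| + r(E − δA) − r(E) turns "A is dependent" into
-- |δA| + 1 ≤ |A| + c(N), where N = E − δA and c counts the components of (V, N).
-- For A = A₁ ⊔ A₂ in the glued graph G, deleting the two new edges from N leaves the disjoint
-- union of N₁ − e₁ and N₂ − e₂, and putting an edge back lowers the number of components by
-- one exactly when it joins two components. Comparing the counts for G, G₁ and G₂ reduces to a
-- Boolean inequality in whether a₁, b₁, a₂, b₂ lie in A and whether aᵢ, bᵢ stay connected in
-- Nᵢ − eᵢ. It shows that a set dependent in G has a part dependent in G₁ or in G₂, and, since
-- Gᵢ − eᵢ is connected, that a set inside one side is dependent in G exactly when it is
-- dependent there. So every circuit of M_G lies on one side and is a circuit of that side.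
module Submission where

open import Defs
open import Data.Nat using (ℕ; zero; suc; _+_; _∸_; _≤_; _<_; _≤?_; z≤n; s≤s; _≤ᵇ_)
open import Data.Nat.Properties
  using ( +-identityʳ; +-comm; +-assoc; +-mono-≤; +-monoˡ-≤; +-monoʳ-≤; +-monoʳ-<
        ; +-cancelʳ-≡; +-cancelˡ-≤; +-cancelʳ-≤; +-cancelˡ-<
        ; ≤-refl; ≤-trans; <-trans; ≤-pred; <-cmp; ≤⇒≯; ≮⇒≥; <⇒≱; ≰⇒>; ≤ᵇ⇒≤
        ; m∸n+n≡m; m≤n+m∸n; m≤n+o⇒m∸n≤o; module ≤-Reasoning )
open import Data.Nat.Tactic.RingSolver using (solve-∀)
open import Data.Fin as Fin using (Fin; toℕ; _≟_; _<?_; splitAt; _↑ˡ_; _↑ʳ_)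
open import Data.Fin.Properties
  using (toℕ-injective; toℕ-↑ˡ; toℕ-↑ʳ; ↑ˡ-injective; ↑ʳ-injective; splitAt-↑ˡ; splitAt-↑ʳ; join-splitAt)
  renaming (suc-injective to Fin-suc-injective)
open import Data.Fin.Subset using (Subset; ∣_∣; ⊤; ∁; ⁅_⁆; _─_; _-_; _∈_; _⊆_; Nonempty) renaming (⊥ to ∅)
open import Data.Fin.Subset.Properties
  using (∣p∣≤n; ∣⊥∣≡0; ∉⊥; ⊥⊆; ⊆-refl; ⊆-antisym; nonempty?; Empty-unique)
open import Data.Vec as Vec using (Vec; []; _∷_; lookup; tabulate; _++_)
open import Data.Vec.Properties
  using ( tabulate-cong; tabulate∘lookup; lookup∘tabulate; lookup-map; lookup-replicate
        ; lookup-++ˡ; lookup-++ʳ; []=⇒lookup; lookup⇒[]=; ++-injectiveˡ; ++-injectiveʳ )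
open import Data.Bool using (Bool; true; false; _∧_; _∨_; not; T)
open import Data.Bool.Properties using (∧-identityʳ; ∧-zeroʳ; ∨-identityʳ; ∨-comm; T-∧; ¬-not)
open import Data.Product using (_×_; _,_; ∃; ∃₂; proj₁; proj₂; map)
open import Data.Sum as Sum using (_⊎_; inj₁; inj₂; swap)
open import Relation.Binary.Construct.Closure.ReflexiveTransitive
  using (Star; ε; _◅_; _◅◅_; reverse; gmap)
open import Relation.Binary.Definitions using (tri<; tri≈; tri>)
open import Relation.Binary.PropositionalEquality
open import Relation.Nullary using (Dec; yes; no; ¬_; contradiction)
open import Relation.Nullary.Decidable using (⌊_⌋)
open import Function using (id; _∘_; case_of_)
open import Function.Bundles using (_⇔_; mk⇔; Equivalence)
open import Function.Construct.Symmetry using (⇔-sym)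
open import Function.Related.Propositional using (module EquationalReasoning)

bit : Bool → ℕ
bit true = 1
bit false = 0

true≢false : true ≢ false
true≢false ()

∨-true⇒ : ∀ a b → a ∨ b ≡ true → a ≡ true ⊎ b ≡ true
∨-true⇒ true b h = inj₁ refl
∨-true⇒ false b h = inj₂ h

∧-true⇒ : ∀ a b → a ∧ b ≡ true → a ≡ true × b ≡ true
∧-true⇒ true true h = refl , refl

∧-true⇐ : ∀ {a b} → a ≡ true → b ≡ true → a ∧ b ≡ true
∧-true⇐ refl refl = refl

∨-trueˡ : ∀ {a} b → a ≡ true → a ∨ b ≡ true
∨-trueˡ b refl = refl

∨-trueʳ : ∀ a {b} → b ≡ true → a ∨ b ≡ true
∨-trueʳ true h = refl
∨-trueʳ false h = h

not-true⇐ : ∀ {b} → b ≢ true → not b ≡ true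
not-true⇐ b≢true = cong not (¬-not b≢true)

not-true⇒ : ∀ {b} → not b ≡ true → b ≢ true
not-true⇒ {true} () _
not-true⇒ {false} _ ()

true⇔⇒≡ : ∀ {a b} → (a ≡ true → b ≡ true) → (b ≡ true → a ≡ true) → a ≡ b
true⇔⇒≡ {true} f g = sym (f refl)
true⇔⇒≡ {false} {true} f g = g refl
true⇔⇒≡ {false} {false} f g = refl

⌊⌋-true⇒ : ∀ {P : Set} (d : Dec P) → ⌊ d ⌋ ≡ true → P
⌊⌋-true⇒ (yes p) h = p

⌊⌋-true⇐ : ∀ {P : Set} (d : Dec P) → P → ⌊ d ⌋ ≡ true
⌊⌋-true⇐ (yes p) _ = refl
⌊⌋-true⇐ (no ¬p) p = contradiction p ¬p

==⇒≡ : ∀ {k} {u v : Fin k} → (u == v) ≡ true → u ≡ v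
==⇒≡ {u = u} {v} = ⌊⌋-true⇒ (u ≟ v)

≡⇒== : ∀ {k} {u v : Fin k} → u ≡ v → (u == v) ≡ true
≡⇒== {u = u} {v} = ⌊⌋-true⇐ (u ≟ v)

==-refl : ∀ {k} (u : Fin k) → (u == u) ≡ true
==-refl u = ≡⇒== refl

≢⇒==-false : ∀ {k} {u v : Fin k} → u ≢ v → (u == v) ≡ false
≢⇒==-false u≢v = ¬-not (λ h → u≢v (==⇒≡ h))

anyF-true⇒ : ∀ {k} (f : Fin k → Bool) → anyF f ≡ true → ∃ λ i → f i ≡ true
anyF-true⇒ {zero} f ()
anyF-true⇒ {suc k} f h with ∨-true⇒ (f Fin.zero) _ h
... | inj₁ p = Fin.zero , p
... | inj₂ p with anyF-true⇒ (λ i → f (Fin.suc i)) p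
... | i , q = Fin.suc i , q

anyF-true⇐ : ∀ {k} (f : Fin k → Bool) i → f i ≡ true → anyF f ≡ true
anyF-true⇐ f Fin.zero p = ∨-trueˡ _ p
anyF-true⇐ f (Fin.suc i) p = ∨-trueʳ (f Fin.zero) (anyF-true⇐ (λ j → f (Fin.suc j)) i p)

anyF-false⇒ : ∀ {k} (f : Fin k → Bool) → anyF f ≡ false → ∀ i → f i ≡ false
anyF-false⇒ f h i = ¬-not (λ p → true≢false (trans (sym (anyF-true⇐ f i p)) h))

anyF-cong : ∀ {k} {f g : Fin k → Bool} → (∀ i → f i ≡ g i) → anyF f ≡ anyF g
anyF-cong {zero} h = refl
anyF-cong {suc k} h = cong₂ _∨_ (h Fin.zero) (anyF-cong (λ i → h (Fin.suc i)))

vec-ext : ∀ {k} {A : Set} (xs ys : Vec A k) → (∀ i → lookup xs i ≡ lookup ys i) → xs ≡ ys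
vec-ext xs ys h = trans (sym (tabulate∘lookup xs)) (trans (tabulate-cong h) (tabulate∘lookup ys))

count-suc : ∀ {k} (f : Fin (suc k) → Bool) → count f ≡ bit (f Fin.zero) + count (λ i → f (Fin.suc i))
count-suc f with f Fin.zero
... | true = refl
... | false = refl

count-cong : ∀ {k} {f g : Fin k → Bool} → (∀ i → f i ≡ g i) → count f ≡ count g
count-cong h = cong ∣_∣ (tabulate-cong h)

count≤ : ∀ {k} (f : Fin k → Bool) → count f ≤ k
count≤ f = ∣p∣≤n (tabulate f)

∣p∣≡count : ∀ {k} (p : Subset k) → ∣ p ∣ ≡ count (lookup p)
∣p∣≡count p = cong ∣_∣ (sym (tabulate∘lookup p))

count-false : ∀ k → count {k} (λ _ → false) ≡ 0
count-false zero = refl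
count-false (suc k) = count-false k

count-++ : ∀ m n (f : Fin (m + n) → Bool) →
           count f ≡ count (λ i → f (i ↑ˡ n)) + count (λ j → f (m ↑ʳ j))
count-++ zero n f = refl
count-++ (suc m) n f = begin
  count f                                                  ≡⟨ count-suc f ⟩
  bit (f Fin.zero) + count (λ i → f (Fin.suc i))           ≡⟨ cong (bit (f Fin.zero) +_) (count-++ m n (λ i → f (Fin.suc i))) ⟩
  bit (f Fin.zero) + (count fˡ + count fʳ)                 ≡⟨ sym (+-assoc (bit (f Fin.zero)) (count fˡ) (count fʳ)) ⟩
  bit (f Fin.zero) + count fˡ + count fʳ                   ≡⟨ cong (_+ count fʳ) (sym (count-suc (λ i → f (i ↑ˡ n)))) ⟩
  count (λ i → f (i ↑ˡ n)) + count fʳ                      ∎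
  where
  open ≡-Reasoning
  fˡ : Fin m → Bool
  fˡ = λ i → f (Fin.suc (i ↑ˡ n))
  fʳ : Fin n → Bool
  fʳ = λ j → f (Fin.suc (m ↑ʳ j))

count-agreeOff : ∀ {k} (f g : Fin k → Bool) (w : Fin k) → (∀ i → i ≢ w → f i ≡ g i) →
                 count f + bit (g w) ≡ count g + bit (f w)
count-agreeOff {suc k} f g Fin.zero h =
  begin
    count f + bit (g Fin.zero)                            ≡⟨ cong (_+ bit (g Fin.zero)) (count-suc f) ⟩
    bit (f Fin.zero) + count f′ + bit (g Fin.zero)        ≡⟨ cong (λ c → bit (f Fin.zero) + c + bit (g Fin.zero)) tails ⟩
    bit (f Fin.zero) + count g′ + bit (g Fin.zero)        ≡⟨ rotate (bit (f Fin.zero)) (bit (g Fin.zero)) (count g′) ⟩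
    bit (g Fin.zero) + count g′ + bit (f Fin.zero)        ≡⟨ cong (_+ bit (f Fin.zero)) (sym (count-suc g)) ⟩
    count g + bit (f Fin.zero)                            ∎
  where
  open ≡-Reasoning
  f′ g′ : Fin k → Bool
  f′ = λ i → f (Fin.suc i)
  g′ = λ i → g (Fin.suc i)
  tails : count f′ ≡ count g′
  tails = count-cong (λ i → h (Fin.suc i) (λ ()))
  rotate : ∀ a b c → a + c + b ≡ b + c + a
  rotate = solve-∀
count-agreeOff {suc k} f g (Fin.suc w) h =
  begin
    count f + bit (g (Fin.suc w))                         ≡⟨ cong (_+ bit (g (Fin.suc w))) (count-suc f) ⟩
    bit (f Fin.zero) + count f′ + bit (g (Fin.suc w))     ≡⟨ +-assoc (bit (f Fin.zero)) (count f′) _ ⟩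
    bit (f Fin.zero) + (count f′ + bit (g (Fin.suc w)))   ≡⟨ cong₂ _+_ (cong bit (h Fin.zero (λ ()))) (count-agreeOff f′ g′ w h′) ⟩
    bit (g Fin.zero) + (count g′ + bit (f (Fin.suc w)))   ≡⟨ sym (+-assoc (bit (g Fin.zero)) (count g′) _) ⟩
    bit (g Fin.zero) + count g′ + bit (f (Fin.suc w))     ≡⟨ cong (_+ bit (f (Fin.suc w))) (sym (count-suc g)) ⟩
    count g + bit (f (Fin.suc w))                         ∎
  where
  open ≡-Reasoning
  f′ g′ : Fin k → Bool
  f′ = λ i → f (Fin.suc i)
  g′ = λ i → g (Fin.suc i)
  h′ : ∀ i → i ≢ w → f′ i ≡ g′ i
  h′ i i≢w = h (Fin.suc i) (λ eq → i≢w (Fin-suc-injective eq))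

count-mono : ∀ {k} (f g : Fin k → Bool) → (∀ i → f i ≡ true → g i ≡ true) → count f ≤ count g
count-mono {zero} f g h = z≤n
count-mono {suc k} f g h rewrite count-suc f | count-suc g =
  +-mono-≤ (bit-mono (h Fin.zero)) (count-mono _ _ (λ i → h (Fin.suc i)))
  where
  bit-mono : ∀ {a b} → (a ≡ true → b ≡ true) → bit a ≤ bit b
  bit-mono {false} _ = z≤n
  bit-mono {true} h with h refl
  ... | refl = ≤-refl

count-remove : ∀ {k} (f : Fin k → Bool) w → f w ≡ true → count f ≡ suc (count (λ i → f i ∧ not (i == w)))
count-remove {k} f w fw =
  begin
    count f                   ≡⟨ sym (+-identityʳ (count f)) ⟩
    count f + 0               ≡⟨ cong (λ b → count f + bit b) (sym f′w) ⟩
    count f + bit (f′ w)      ≡⟨ count-agreeOff f f′ w agree ⟩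
    count f′ + bit (f w)      ≡⟨ cong (λ b → count f′ + bit b) fw ⟩
    count f′ + 1              ≡⟨ +-comm (count f′) 1 ⟩
    suc (count f′)            ∎
  where
  open ≡-Reasoning
  f′ : Fin k → Bool
  f′ = λ i → f i ∧ not (i == w)
  f′w : f′ w ≡ false
  f′w rewrite ==-refl w = ∧-zeroʳ (f w)
  agree : ∀ i → i ≢ w → f i ≡ f′ i
  agree i i≢w rewrite ≢⇒==-false i≢w = sym (∧-identityʳ (f i))

count-pos : ∀ {k} (f : Fin k → Bool) w → f w ≡ true → 1 ≤ count f
count-pos f w fw rewrite count-remove f w fw = s≤s z≤n

count-strict : ∀ {k} (f g : Fin k → Bool) → (∀ i → f i ≡ true → g i ≡ true) →
               ∀ w → f w ≡ false → g w ≡ true → count f < count g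
count-strict f g f⊆g w fw gw rewrite count-remove g w gw = s≤s (count-mono f _ f⊆g′)
  where
  f⊆g′ : ∀ i → f i ≡ true → g i ∧ not (i == w) ≡ true
  f⊆g′ i fi = ∧-true⇐ (f⊆g i fi) (not-true⇐ λ i==w →
    true≢false (trans (sym fi) (trans (cong f (==⇒≡ i==w)) fw)))

count-single : ∀ {k} (f : Fin k → Bool) w → f w ≡ true → (∀ i → i ≢ w → f i ≡ false) → count f ≡ 1
count-single {k} f w fw h =
  trans (sym (+-identityʳ _))
        (trans (count-agreeOff f (λ _ → false) w h) (cong₂ _+_ (count-false k) (cong bit fw)))

lookup-∁ : ∀ {k} (p : Subset k) i → lookup (∁ p) i ≡ not (lookup p i)
lookup-∁ p i = lookup-map i not p

lookup-∅ : ∀ {k} (i : Fin k) → lookup (∅ {k}) i ≡ false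
lookup-∅ i = lookup-replicate i false

lookup-⁅⁆ : ∀ {k} (x i : Fin k) → lookup ⁅ x ⁆ i ≡ (i == x)
lookup-⁅⁆ Fin.zero Fin.zero = refl
lookup-⁅⁆ Fin.zero (Fin.suc i) = lookup-∅ i
lookup-⁅⁆ (Fin.suc x) Fin.zero = refl
lookup-⁅⁆ (Fin.suc x) (Fin.suc i) =
  trans (lookup-⁅⁆ x i)
        (true⇔⇒≡ (λ h → ≡⇒== (cong Fin.suc (==⇒≡ h))) (λ h → ≡⇒== (Fin-suc-injective (==⇒≡ h))))

lookup-─ : ∀ {k} (p q : Subset k) i → lookup (p ─ q) i ≡ lookup p i ∧ not (lookup q i)
lookup-─ (b ∷ p) (true ∷ q) Fin.zero = sym (∧-zeroʳ b)
lookup-─ (b ∷ p) (false ∷ q) Fin.zero = sym (∧-identityʳ b)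
lookup-─ (_ ∷ p) (_ ∷ q) (Fin.suc i) = lookup-─ p q i

lookup-─⁅⁆ : ∀ {k} (p : Subset k) x i → lookup (p - x) i ≡ lookup p i ∧ not (i == x)
lookup-─⁅⁆ p x i = trans (lookup-─ p ⁅ x ⁆ i) (cong (λ b → lookup p i ∧ not b) (lookup-⁅⁆ x i))

lookup-─⁅⁆-self : ∀ {k} (p : Subset k) x → lookup (p - x) x ≡ false
lookup-─⁅⁆-self p x rewrite lookup-─⁅⁆ p x x | ==-refl x = ∧-zeroʳ (lookup p x)

lookup-─⁅⁆-other : ∀ {k} (p : Subset k) {x i} → i ≢ x → lookup (p - x) i ≡ lookup p i
lookup-─⁅⁆-other p {x} {i} i≢x rewrite lookup-─⁅⁆ p x i | ≢⇒==-false i≢x = ∧-identityʳ (lookup p i)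

─⁅⁆-absent : ∀ {k} (p : Subset k) {x} → lookup p x ≡ false → p - x ≡ p
─⁅⁆-absent p {x} x∉p = vec-ext _ _ λ i → case i ≟ x of λ
  { (yes refl) → trans (lookup-─⁅⁆-self p x) (sym x∉p)
  ; (no i≢x) → lookup-─⁅⁆-other p i≢x }

⊤-─⁅⁆ : ∀ {k} (x : Fin k) → ⊤ - x ≡ ∁ ⁅ x ⁆
⊤-─⁅⁆ x = vec-ext _ _ λ i →
  trans (lookup-─⁅⁆ ⊤ x i) (trans (cong (_∧ not (i == x)) (lookup-replicate i true))
                                 (sym (trans (lookup-∁ ⁅ x ⁆ i) (cong not (lookup-⁅⁆ x i)))))

↑ˡ≢↑ʳ : ∀ {m n} (i : Fin m) (j : Fin n) → i ↑ˡ n ≢ m ↑ʳ j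
↑ˡ≢↑ʳ {m} {n} i j eq with trans (sym (splitAt-↑ˡ m i n)) (trans (cong (splitAt m) eq) (splitAt-↑ʳ m n j))
... | ()

↑-cases : ∀ m n (w : Fin (m + n)) → (∃ λ i → w ≡ i ↑ˡ n) ⊎ (∃ λ j → w ≡ m ↑ʳ j)
↑-cases m n w with splitAt m w | join-splitAt m n w
... | inj₁ i | eq = inj₁ (i , sym eq)
... | inj₂ j | eq = inj₂ (j , sym eq)

∅++∅ : ∀ m n → ∅ {m} ++ ∅ {n} ≡ ∅
∅++∅ zero n = refl
∅++∅ (suc m) n = cong (false ∷_) (∅++∅ m n)

∣++∣ : ∀ {m n} (p : Subset m) (q : Subset n) → ∣ p ++ q ∣ ≡ ∣ p ∣ + ∣ q ∣
∣++∣ {m} {n} p q = trans (∣p∣≡count (p ++ q)) (trans (count-++ m n (lookup (p ++ q)))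
  (sym (cong₂ _+_ (trans (∣p∣≡count p) (count-cong λ i → sym (lookup-++ˡ p q i)))
                  (trans (∣p∣≡count q) (count-cong λ i → sym (lookup-++ʳ p q i))))))

∈-↑ˡ⇔ : ∀ {m n} {p : Subset m} {q : Subset n} {x} → (x ↑ˡ n ∈ p ++ q) ⇔ (x ∈ p)
∈-↑ˡ⇔ {p = p} {q} {x} = mk⇔ (λ h → lookup⇒[]= x p (trans (sym (lookup-++ˡ p q x)) ([]=⇒lookup h)))
                            (λ h → lookup⇒[]= _ (p ++ q) (trans (lookup-++ˡ p q x) ([]=⇒lookup h)))

∈-↑ʳ⇔ : ∀ {m n} {p : Subset m} {q : Subset n} {y} → (m ↑ʳ y ∈ p ++ q) ⇔ (y ∈ q)
∈-↑ʳ⇔ {p = p} {q} {y} = mk⇔ (λ h → lookup⇒[]= y q (trans (sym (lookup-++ʳ p q y)) ([]=⇒lookup h)))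
                            (λ h → lookup⇒[]= _ (p ++ q) (trans (lookup-++ʳ p q y) ([]=⇒lookup h)))

Nonempty-++ˡ : ∀ {m n} {p : Subset m} (q : Subset n) → Nonempty p → Nonempty (p ++ q)
Nonempty-++ˡ q (x , x∈p) = _ , Equivalence.from ∈-↑ˡ⇔ x∈p

Nonempty-++ʳ : ∀ {m n} (p : Subset m) {q : Subset n} → Nonempty q → Nonempty (p ++ q)
Nonempty-++ʳ p (y , y∈q) = _ , Equivalence.from (∈-↑ʳ⇔ {p = p}) y∈q

Nonempty-++⁻ : ∀ {m n} (p : Subset m) (q : Subset n) → Nonempty (p ++ q) → Nonempty p ⊎ Nonempty q
Nonempty-++⁻ {m} {n} p q (w , w∈) with ↑-cases m n w
... | inj₁ (x , refl) = inj₁ (x , Equivalence.to ∈-↑ˡ⇔ w∈)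
... | inj₂ (y , refl) = inj₂ (y , Equivalence.to (∈-↑ʳ⇔ {p = p}) w∈)

⊆-++⁺ : ∀ {m n} {p p′ : Subset m} {q q′ : Subset n} → p ⊆ p′ → q ⊆ q′ → p ++ q ⊆ p′ ++ q′
⊆-++⁺ {m} {n} {p} {p′} p⊆p′ q⊆q′ {w} w∈ with ↑-cases m n w
... | inj₁ (x , refl) = Equivalence.from ∈-↑ˡ⇔ (p⊆p′ (Equivalence.to ∈-↑ˡ⇔ w∈))
... | inj₂ (y , refl) = Equivalence.from (∈-↑ʳ⇔ {p = p′}) (q⊆q′ (Equivalence.to (∈-↑ʳ⇔ {p = p}) w∈))

⊆-++⁻ˡ : ∀ {m n} {p p′ : Subset m} {q q′ : Subset n} → p ++ q ⊆ p′ ++ q′ → p ⊆ p′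
⊆-++⁻ˡ h x∈p = Equivalence.to ∈-↑ˡ⇔ (h (Equivalence.from ∈-↑ˡ⇔ x∈p))

⊆-++⁻ʳ : ∀ {m n} {p p′ : Subset m} {q q′ : Subset n} → p ++ q ⊆ p′ ++ q′ → q ⊆ q′
⊆-++⁻ʳ {p = p} {p′} h y∈q = Equivalence.to (∈-↑ʳ⇔ {p = p′}) (h (Equivalence.from (∈-↑ʳ⇔ {p = p}) y∈q))

¬Nonempty-∅ : ∀ {k} → ¬ Nonempty (∅ {k})
¬Nonempty-∅ (_ , x∈∅) = ∉⊥ x∈∅

⊆∅⇒≡∅ : ∀ {k} {p : Subset k} → p ⊆ ∅ → p ≡ ∅
⊆∅⇒≡∅ p⊆∅ = ⊆-antisym p⊆∅ ⊥⊆

lookup-δ : ∀ H (A : Subset (nV H)) e →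
           lookup (δ H A) e ≡ lookup A (proj₁ (ends H e)) ∨ lookup A (proj₂ (ends H e))
lookup-δ H A e = lookup∘tabulate _ e

lookup-δ-EdgeBetween : ∀ H (A : Subset (nV H)) {e a b} → EdgeBetween H e a b →
                       lookup (δ H A) e ≡ lookup A a ∨ lookup A b
lookup-δ-EdgeBetween H A {e} (inj₁ eq) rewrite lookup-δ H A e | eq = refl
lookup-δ-EdgeBetween H A {e} {a} {b} (inj₂ eq) rewrite lookup-δ H A e | eq = ∨-comm (lookup A b) (lookup A a)

δ-∅ : ∀ H e → lookup (δ H ∅) e ≡ false
δ-∅ H e rewrite lookup-δ H ∅ e | lookup-∅ (proj₁ (ends H e)) | lookup-∅ (proj₂ (ends H e)) = refl

∣δ-∅∣ : ∀ H → ∣ δ H ∅ ∣ ≡ 0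
∣δ-∅∣ H = trans (∣p∣≡count (δ H ∅)) (trans (count-cong (δ-∅ H)) (count-false (nE H)))

∁δ∅≡⊤ : ∀ H → ∁ (δ H ∅) ≡ ⊤
∁δ∅≡⊤ H = vec-ext _ _ λ e →
  trans (lookup-∁ (δ H ∅) e) (trans (cong not (δ-∅ H e)) (sym (lookup-replicate e true)))

module Connectivity (H : Graph) where
  src tgt : Fin (nE H) → Fin (nV H)
  src e = proj₁ (ends H e)
  tgt e = proj₂ (ends H e)

  data Step (Y : Subset (nE H)) (u v : Fin (nV H)) : Set where
    step : ∀ e → lookup Y e ≡ true → EdgeBetween H e u v → Step Y u v

  Path : Subset (nE H) → Fin (nV H) → Fin (nV H) → Set
  Path Y = Star (Step Y)

  Step-sym : ∀ {Y u v} → Step Y u v → Step Y v u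
  Step-sym (step e y uv) = step e y (swap uv)

  Path-sym : ∀ {Y u v} → Path Y u v → Path Y v u
  Path-sym = reverse Step-sym

  ≡⇒Path : ∀ {Y u v} → u ≡ v → Path Y u v
  ≡⇒Path refl = ε

  edge-Path : ∀ {Y} e → lookup Y e ≡ true → Path Y (src e) (tgt e)
  edge-Path e y = step e y (inj₁ refl) ◅ ε

  reach⇒Path : ∀ Y k u v → reach H Y k u v ≡ true → Path Y u v
  reach⇒Path Y zero u v h = ≡⇒Path (==⇒≡ h)
  reach⇒Path Y (suc k) u v h with ∨-true⇒ (reach H Y k u v) _ h
  ... | inj₁ r = reach⇒Path Y k u v r
  ... | inj₂ r with anyF-true⇒ _ r
  ... | e , q with ∧-true⇒ (lookup Y e) _ q
  ... | y , q′ with ∨-true⇒ (reach H Y k u (src e) ∧ (tgt e == v)) _ q′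
  ... | inj₁ s with ∧-true⇒ _ _ s
  ...   | r₁ , t = reach⇒Path Y k u (src e) r₁ ◅◅ step e y (inj₁ (cong (src e ,_) (==⇒≡ t))) ◅ ε
  reach⇒Path Y (suc k) u v h | inj₂ r | e , q | y , q′ | inj₂ s with ∧-true⇒ _ _ s
  ...   | r₁ , t = reach⇒Path Y k u (tgt e) r₁ ◅◅ step e y (inj₂ (cong (_, tgt e) (==⇒≡ t))) ◅ ε

  reach-suc : ∀ Y k u v → reach H Y k u v ≡ true → reach H Y (suc k) u v ≡ true
  reach-suc Y k u v = ∨-trueˡ _

  reach-+ : ∀ Y m k u v → reach H Y k u v ≡ true → reach H Y (m + k) u v ≡ true
  reach-+ Y zero k u v r = r
  reach-+ Y (suc m) k u v r = reach-suc Y (m + k) u v (reach-+ Y m k u v r)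

  reach-Step : ∀ {Y k u w v} → reach H Y k u w ≡ true → Step Y w v → reach H Y (suc k) u v ≡ true
  reach-Step {Y} {k} {u} {w} {v} r (step e y (inj₁ eq)) =
    ∨-trueʳ (reach H Y k u v) (anyF-true⇐ _ e (∧-true⇐ y (∨-trueˡ _
      (∧-true⇐ (subst (λ x → reach H Y k u x ≡ true) (sym (cong proj₁ eq)) r) (≡⇒== (cong proj₂ eq))))))
  reach-Step {Y} {k} {u} {w} {v} r (step e y (inj₂ eq)) =
    ∨-trueʳ (reach H Y k u v) (anyF-true⇐ _ e (∧-true⇐ y (∨-trueʳ _
      (∧-true⇐ (subst (λ x → reach H Y k u x ≡ true) (sym (cong proj₂ eq)) r) (≡⇒== (cong proj₁ eq))))))

  Path⇒reach : ∀ {Y} k {u w v} → reach H Y k u w ≡ true → Path Y w v → ∃ λ k′ → reach H Y k′ u v ≡ true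
  Path⇒reach k r ε = k , r
  Path⇒reach {Y} k {u} r (s ◅ p) = Path⇒reach (suc k) (reach-Step {Y} {k} {u} r s) p

  Stable : Subset (nE H) → ℕ → Fin (nV H) → Set
  Stable Y k u = ∀ v → reach H Y (suc k) u v ≡ reach H Y k u v

  stable-suc : ∀ Y k u → Stable Y k u → Stable Y (suc k) u
  stable-suc Y k u st v = cong₂ _∨_ (st v) (anyF-cong (λ e → cong (lookup Y e ∧_)
    (cong₂ _∨_ (cong (_∧ (tgt e == v)) (st (src e))) (cong (_∧ (src e == v)) (st (tgt e))))))

  -- Every round before reach stabilises adds a vertex, so it is stable after nV H rounds.
  grows-or-stable : ∀ Y u k → suc k ≤ count (reach H Y k u) ⊎ Stable Y k u
  grows-or-stable Y u zero = inj₁ (count-pos _ u (==-refl u))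
  grows-or-stable Y u (suc k) with grows-or-stable Y u k
  ... | inj₂ st = inj₂ (stable-suc Y k u st)
  ... | inj₁ grown with anyF (λ v → reach H Y (suc k) u v ∧ not (reach H Y k u v)) in new
  ... | true with anyF-true⇒ _ new
  ... | v , q with ∧-true⇒ _ _ q
  ... | now , ¬before =
    inj₁ (≤-trans (s≤s grown) (count-strict _ _ (reach-suc Y k u) v (¬-not (not-true⇒ ¬before)) now))
  grows-or-stable Y u (suc k) | inj₁ _ | false = inj₂ (stable-suc Y k u st)
    where
    no-new : ∀ {a b} → a ∧ not b ≡ false → a ≡ true → b ≡ true
    no-new {b = true} _ _ = refl
    no-new {true} {false} () refl
    st : Stable Y k u
    st v = true⇔⇒≡ (no-new (anyF-false⇒ _ new v)) (reach-suc Y k u v)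

  stable-nV : ∀ Y u → Stable Y (nV H) u
  stable-nV Y u with grows-or-stable Y u (nV H)
  ... | inj₂ st = st
  ... | inj₁ grown = contradiction grown (≤⇒≯ (count≤ (reach H Y (nV H) u)))

  reach-beyond-nV : ∀ Y u m v → reach H Y (m + nV H) u v ≡ connectedIn H Y u v
  reach-beyond-nV Y u zero v = refl
  reach-beyond-nV Y u (suc m) v = trans (stable-beyond m v) (reach-beyond-nV Y u m v)
    where
    stable-beyond : ∀ m → Stable Y (m + nV H) u
    stable-beyond zero = stable-nV Y u
    stable-beyond (suc m) = stable-suc Y (m + nV H) u (stable-beyond m)

  Path⇒connectedIn : ∀ {Y u v} → Path Y u v → connectedIn H Y u v ≡ true
  Path⇒connectedIn {Y} {u} {v} p with Path⇒reach 0 (==-refl u) p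
  ... | k , r = trans (sym (reach-beyond-nV Y u k v))
                      (subst (λ j → reach H Y j u v ≡ true) (+-comm (nV H) k) (reach-+ Y (nV H) k u v r))

  connectedIn⇒Path : ∀ {Y u v} → connectedIn H Y u v ≡ true → Path Y u v
  connectedIn⇒Path {Y} {u} {v} = reach⇒Path Y (nV H) u v

  IsLeast : Subset (nE H) → Fin (nV H) → Set
  IsLeast Y v = ∀ u → u Fin.< v → ¬ Path Y u v

  leader : Subset (nE H) → Fin (nV H) → Bool
  leader Y v = not (anyF (λ u → ⌊ u <? v ⌋ ∧ connectedIn H Y u v))

  leader⇒IsLeast : ∀ {Y v} → leader Y v ≡ true → IsLeast Y v
  leader⇒IsLeast {Y} {v} h u u<v p =
    not-true⇒ h (anyF-true⇐ _ u (∧-true⇐ (⌊⌋-true⇐ (u <? v) u<v) (Path⇒connectedIn p)))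

  IsLeast⇒leader : ∀ {Y v} → IsLeast Y v → leader Y v ≡ true
  IsLeast⇒leader {Y} {v} least = not-true⇐ λ h →
    let (u , q) = anyF-true⇒ _ h
        (u<v , uv) = ∧-true⇒ _ _ q
    in least u (⌊⌋-true⇒ (u <? v) u<v) (connectedIn⇒Path uv)

  least-exists : ∀ Y x → ∃ λ m → Path Y m x × IsLeast Y m
  least-exists Y x = go (suc (toℕ x)) x ≤-refl
    where
    go : ∀ fuel x → toℕ x < fuel → ∃ λ m → Path Y m x × IsLeast Y m
    go (suc fuel) x x<fuel with anyF (λ u → ⌊ u <? x ⌋ ∧ connectedIn H Y u x) in below
    ... | false = x , ε , leader⇒IsLeast (cong not below)
    ... | true with anyF-true⇒ _ below
    ... | u , q with ∧-true⇒ _ _ q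
    ... | u<x , ux with go fuel u (≤-trans (⌊⌋-true⇒ (u <? x) u<x) (≤-pred x<fuel))
    ... | m , mu , least = m , mu ◅◅ connectedIn⇒Path ux , least

  least-unique : ∀ {Y m m′} → IsLeast Y m → IsLeast Y m′ → Path Y m m′ → m ≡ m′
  least-unique {m = m} {m′} least least′ p with <-cmp (toℕ m) (toℕ m′)
  ... | tri< m<m′ _ _ = contradiction p (least′ m m<m′)
  ... | tri≈ _ m≡m′ _ = toℕ-injective m≡m′
  ... | tri> _ _ m′<m = contradiction (Path-sym p) (least m′ m′<m)

  least-≤ : ∀ {Y m u} → IsLeast Y m → Path Y m u → toℕ m ≤ toℕ u
  least-≤ {u = u} least p = ≮⇒≥ (λ u<m → least u u<m (Path-sym p))

  components-cong : ∀ Y Y′ → (∀ {u v} → Path Y u v → Path Y′ u v) → (∀ {u v} → Path Y′ u v → Path Y u v) →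
                    components H Y ≡ components H Y′
  components-cong Y Y′ to from = count-cong {f = leader Y} {g = leader Y′} λ v → true⇔⇒≡
    (λ h → IsLeast⇒leader {Y′} (λ u u<v p → leader⇒IsLeast {Y} h u u<v (from p)))
    (λ h → IsLeast⇒leader {Y} (λ u u<v p → leader⇒IsLeast {Y′} h u u<v (to p)))

  components-connected : ∀ Y → (∀ u v → connectedIn H Y u v ≡ true) → Fin (nV H) → components H Y ≡ 1
  components-connected Y connected v with least-exists Y v
  ... | m , _ , least = count-single (leader Y) m (IsLeast⇒leader least)
        (λ i i≢m → ¬-not λ h → i≢m (least-unique (leader⇒IsLeast h) least (connectedIn⇒Path (connected i m))))

  module AddEdge (Y Y⁺ : Subset (nE H)) (e : Fin (nE H)) (e∈Y⁺ : lookup Y⁺ e ≡ true)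
                 (agree : ∀ f → f ≢ e → lookup Y⁺ f ≡ lookup Y f) where

    Via : Fin (nV H) → Fin (nV H) → Fin (nV H) → Fin (nV H) → Set
    Via a b u v = Path Y u v ⊎ (Path Y u a × Path Y b v) ⊎ (Path Y u b × Path Y a v)

    Via-swap : ∀ {a b u v} → Via a b u v → Via b a u v
    Via-swap (inj₁ p) = inj₁ p
    Via-swap (inj₂ (inj₁ q)) = inj₂ (inj₂ q)
    Via-swap (inj₂ (inj₂ q)) = inj₂ (inj₁ q)

    Via-trans : ∀ {a b u w v} → Via a b u w → Via a b w v → Via a b u v
    Via-trans (inj₁ p) (inj₁ q) = inj₁ (p ◅◅ q)
    Via-trans (inj₁ p) (inj₂ (inj₁ (q , r))) = inj₂ (inj₁ (p ◅◅ q , r))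
    Via-trans (inj₁ p) (inj₂ (inj₂ (q , r))) = inj₂ (inj₂ (p ◅◅ q , r))
    Via-trans (inj₂ (inj₁ (p , q))) (inj₁ r) = inj₂ (inj₁ (p , q ◅◅ r))
    Via-trans (inj₂ (inj₁ (p , _))) (inj₂ (inj₁ (_ , s))) = inj₂ (inj₁ (p , s))
    Via-trans (inj₂ (inj₁ (p , _))) (inj₂ (inj₂ (_ , s))) = inj₁ (p ◅◅ s)
    Via-trans (inj₂ (inj₂ (p , q))) (inj₁ r) = inj₂ (inj₂ (p , q ◅◅ r))
    Via-trans (inj₂ (inj₂ (p , _))) (inj₂ (inj₁ (_ , s))) = inj₁ (p ◅◅ s)
    Via-trans (inj₂ (inj₂ (p , _))) (inj₂ (inj₂ (_ , s))) = inj₂ (inj₂ (p , s))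

    Y⊆Y⁺ : ∀ f → lookup Y f ≡ true → lookup Y⁺ f ≡ true
    Y⊆Y⁺ f y with f ≟ e
    ... | yes refl = e∈Y⁺
    ... | no f≢e = trans (agree f f≢e) y

    Path⇒Path⁺ : ∀ {u v} → Path Y u v → Path Y⁺ u v
    Path⇒Path⁺ = gmap id λ { (step f y fuv) → step f (Y⊆Y⁺ f y) fuv }

    Step⁺⇒Via : ∀ {u v} → Step Y⁺ u v → Via (src e) (tgt e) u v
    Step⁺⇒Via (step f y⁺ fuv) with f ≟ e
    Step⁺⇒Via (step f y⁺ (inj₁ eq)) | yes refl = inj₂ (inj₁ (≡⇒Path (sym (cong proj₁ eq)) , ≡⇒Path (cong proj₂ eq)))
    Step⁺⇒Via (step f y⁺ (inj₂ eq)) | yes refl = inj₂ (inj₂ (≡⇒Path (sym (cong proj₂ eq)) , ≡⇒Path (cong proj₁ eq)))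
    ... | no f≢e = inj₁ (step f (trans (sym (agree f f≢e)) y⁺) fuv ◅ ε)

    Path⁺⇒Via : ∀ {u v} → Path Y⁺ u v → Via (src e) (tgt e) u v
    Path⁺⇒Via ε = inj₁ ε
    Path⁺⇒Via (s ◅ p) = Via-trans (Step⁺⇒Via s) (Path⁺⇒Via p)

    Via⇒Path⁺ : ∀ {u v} → Via (src e) (tgt e) u v → Path Y⁺ u v
    Via⇒Path⁺ (inj₁ p) = Path⇒Path⁺ p
    Via⇒Path⁺ (inj₂ (inj₁ (p , q))) = Path⇒Path⁺ p ◅◅ edge-Path e e∈Y⁺ ◅◅ Path⇒Path⁺ q
    Via⇒Path⁺ (inj₂ (inj₂ (p , q))) = Path⇒Path⁺ p ◅◅ Path-sym (edge-Path e e∈Y⁺) ◅◅ Path⇒Path⁺ q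

    components-add-inside : Path Y (src e) (tgt e) → components H Y⁺ ≡ components H Y
    components-add-inside xy = components-cong Y⁺ Y (λ p → short (Path⁺⇒Via p)) Path⇒Path⁺
      where
      short : ∀ {u v} → Via (src e) (tgt e) u v → Path Y u v
      short (inj₁ p) = p
      short (inj₂ (inj₁ (p , q))) = p ◅◅ xy ◅◅ q
      short (inj₂ (inj₂ (p , q))) = p ◅◅ Path-sym xy ◅◅ q

    -- The least vertex mb of the component of b stops being a leader; no other leader changes.
    private
      merge : ∀ a b → (∀ {u v} → Path Y⁺ u v → Via a b u v) → Path Y⁺ a b →
              ∀ {ma mb} → Path Y ma a → Path Y mb b → IsLeast Y ma → IsLeast Y mb → ma Fin.< mb →
              components H Y ≡ suc (components H Y⁺)
      merge a b via ab {ma} {mb} pa pb least-a least-b ma<mb =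
        begin
          count (leader Y)                             ≡⟨ sym (+-identityʳ _) ⟩
          count (leader Y) + 0                         ≡⟨ cong (λ z → count (leader Y) + bit z) (sym not-leader⁺) ⟩
          count (leader Y) + bit (leader Y⁺ mb)        ≡⟨ count-agreeOff (leader Y) (leader Y⁺) mb same-leaders ⟩
          count (leader Y⁺) + bit (leader Y mb)        ≡⟨ cong (λ z → count (leader Y⁺) + bit z) (IsLeast⇒leader least-b) ⟩
          count (leader Y⁺) + 1                        ≡⟨ +-comm _ 1 ⟩
          suc (count (leader Y⁺))                      ∎
        where
        open ≡-Reasoning
        not-leader⁺ : leader Y⁺ mb ≡ false
        not-leader⁺ = ¬-not λ h →
          leader⇒IsLeast {Y⁺} h ma ma<mb (Path⇒Path⁺ pa ◅◅ ab ◅◅ Path⇒Path⁺ (Path-sym pb))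
        not-via : ∀ {u i} → i ≢ mb → u Fin.< i → Via a b u i → ¬ IsLeast Y i
        not-via i≢mb u<i (inj₁ p) least-i = least-i _ u<i p
        not-via i≢mb u<i (inj₂ (inj₁ (_ , bi))) least-i =
          i≢mb (least-unique least-i least-b (Path-sym bi ◅◅ Path-sym pb))
        not-via i≢mb u<i (inj₂ (inj₂ (ub , ai))) least-i
          with least-unique least-i least-a (Path-sym ai ◅◅ Path-sym pa)
        ... | refl = <⇒≱ (<-trans u<i ma<mb) (least-≤ least-b (pb ◅◅ Path-sym ub))
        same-leaders : ∀ i → i ≢ mb → leader Y i ≡ leader Y⁺ i
        same-leaders i i≢mb = true⇔⇒≡
          (λ h → IsLeast⇒leader {Y⁺} (λ u u<i p → not-via i≢mb u<i (via p) (leader⇒IsLeast {Y} h)))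
          (λ h → IsLeast⇒leader {Y} (λ u u<i p → leader⇒IsLeast {Y⁺} h u u<i (Path⇒Path⁺ p)))

    components-add-bridge : ¬ Path Y (src e) (tgt e) → components H Y ≡ suc (components H Y⁺)
    components-add-bridge ¬xy with least-exists Y (src e) | least-exists Y (tgt e)
    ... | mx , px , least-x | my , py , least-y with <-cmp (toℕ mx) (toℕ my)
    ... | tri< mx<my _ _ = merge (src e) (tgt e) Path⁺⇒Via (edge-Path e e∈Y⁺) px py least-x least-y mx<my
    ... | tri≈ _ mx≡my _ = contradiction (Path-sym px ◅◅ ≡⇒Path (toℕ-injective mx≡my) ◅◅ py) ¬xy
    ... | tri> _ _ my<mx =
      merge (tgt e) (src e) (Via-swap ∘ Path⁺⇒Via) (Path-sym (edge-Path e e∈Y⁺)) py px least-y least-x my<mx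

  connectedIn-sym : ∀ {Y u v} → connectedIn H Y u v ≡ connectedIn H Y v u
  connectedIn-sym = true⇔⇒≡ (λ h → Path⇒connectedIn (Path-sym (connectedIn⇒Path h)))
                            (λ h → Path⇒connectedIn (Path-sym (connectedIn⇒Path h)))

  connectedIn-EdgeBetween : ∀ {Y e a b} → EdgeBetween H e a b →
                            connectedIn H Y (src e) (tgt e) ≡ connectedIn H Y a b
  connectedIn-EdgeBetween (inj₁ eq) rewrite eq = refl
  connectedIn-EdgeBetween (inj₂ eq) rewrite eq = connectedIn-sym

  components-─ : ∀ Y {e a b} → EdgeBetween H e a b →
                 components H Y + bit (lookup Y e ∧ not (connectedIn H (Y - e) a b)) ≡ components H (Y - e)
  components-─ Y {e} {a} {b} eab with lookup Y e in e∈Y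
  ... | false = trans (+-identityʳ _) (cong (components H) (sym (─⁅⁆-absent Y e∈Y)))
  ... | true = by-bridge (connectedIn H (Y - e) a b) refl
    where
    agree : ∀ f → f ≢ e → lookup Y f ≡ lookup (Y - e) f
    agree f f≢e = sym (lookup-─⁅⁆-other Y f≢e)
    open AddEdge (Y - e) Y e e∈Y agree using (components-add-inside; components-add-bridge)
    ab⇔ : ∀ {c} → connectedIn H (Y - e) a b ≡ c → connectedIn H (Y - e) (src e) (tgt e) ≡ c
    ab⇔ = trans (connectedIn-EdgeBetween {Y - e} eab)
    by-bridge : ∀ c → connectedIn H (Y - e) a b ≡ c →
                components H Y + bit (true ∧ not c) ≡ components H (Y - e)
    by-bridge true ab = trans (+-identityʳ _) (components-add-inside (connectedIn⇒Path (ab⇔ ab)))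
    by-bridge false ab =
      trans (+-comm _ 1) (sym (components-add-bridge λ p → true≢false (trans (sym (Path⇒connectedIn p)) (ab⇔ ab))))

module Glue (G₁ G₂ : Graph) (e₁ : Fin (nE G₁)) (e₂ : Fin (nE G₂))
            (a₁ b₁ : Fin (nV G₁)) (a₂ b₂ : Fin (nV G₂)) where

  G : Graph
  G = glue G₁ G₂ e₁ e₂ a₁ b₁ a₂ b₂

  module C₁ = Connectivity G₁
  module C₂ = Connectivity G₂
  module C = Connectivity G

  ι₁ : Fin (nV G₁) → Fin (nV G)
  ι₁ i = i ↑ˡ nV G₂
  ι₂ : Fin (nV G₂) → Fin (nV G)
  ι₂ j = nV G₁ ↑ʳ j
  edge₁ : Fin (nE G₁) → Fin (nE G)
  edge₁ e = e ↑ˡ nE G₂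
  edge₂ : Fin (nE G₂) → Fin (nE G)
  edge₂ e = nE G₁ ↑ʳ e

  link₁ link₂ : Fin (nE G)
  link₁ = edge₁ e₁
  link₂ = edge₂ e₂

  ends-edge₁ : ∀ e → e ≢ e₁ → ends G (edge₁ e) ≡ map ι₁ ι₁ (ends G₁ e)
  ends-edge₁ e e≢e₁ rewrite splitAt-↑ˡ (nE G₁) e (nE G₂) | ≢⇒==-false e≢e₁ = refl
  ends-edge₂ : ∀ e → e ≢ e₂ → ends G (edge₂ e) ≡ map ι₂ ι₂ (ends G₂ e)
  ends-edge₂ e e≢e₂ rewrite splitAt-↑ʳ (nE G₁) (nE G₂) e | ≢⇒==-false e≢e₂ = refl
  ends-link₁ : ends G link₁ ≡ (ι₁ a₁ , ι₂ a₂)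
  ends-link₁ rewrite splitAt-↑ˡ (nE G₁) e₁ (nE G₂) | ==-refl e₁ = refl
  ends-link₂ : ends G link₂ ≡ (ι₁ b₁ , ι₂ b₂)
  ends-link₂ rewrite splitAt-↑ʳ (nE G₁) (nE G₂) e₂ | ==-refl e₂ = refl

  lift₁ : ∀ {e i j} → e ≢ e₁ → EdgeBetween G₁ e i j → EdgeBetween G (edge₁ e) (ι₁ i) (ι₁ j)
  lift₁ {e} e≢e₁ = Sum.map lift lift
    where
    lift : ∀ {p} → ends G₁ e ≡ p → ends G (edge₁ e) ≡ map ι₁ ι₁ p
    lift eq = trans (ends-edge₁ e e≢e₁) (cong (map ι₁ ι₁) eq)
  lift₂ : ∀ {e i j} → e ≢ e₂ → EdgeBetween G₂ e i j → EdgeBetween G (edge₂ e) (ι₂ i) (ι₂ j)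
  lift₂ {e} e≢e₂ = Sum.map lift lift
    where
    lift : ∀ {p} → ends G₂ e ≡ p → ends G (edge₂ e) ≡ map ι₂ ι₂ p
    lift eq = trans (ends-edge₂ e e≢e₂) (cong (map ι₂ ι₂) eq)

  unlift₁ : ∀ {e u v} → e ≢ e₁ → EdgeBetween G (edge₁ e) u v →
            ∃₂ λ i j → u ≡ ι₁ i × v ≡ ι₁ j × EdgeBetween G₁ e i j
  unlift₁ {e} e≢e₁ (inj₁ eq) with trans (sym (ends-edge₁ e e≢e₁)) eq
  ... | refl = C₁.src e , C₁.tgt e , refl , refl , inj₁ refl
  unlift₁ {e} e≢e₁ (inj₂ eq) with trans (sym (ends-edge₁ e e≢e₁)) eq
  ... | refl = C₁.tgt e , C₁.src e , refl , refl , inj₂ refl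
  unlift₂ : ∀ {e u v} → e ≢ e₂ → EdgeBetween G (edge₂ e) u v →
            ∃₂ λ i j → u ≡ ι₂ i × v ≡ ι₂ j × EdgeBetween G₂ e i j
  unlift₂ {e} e≢e₂ (inj₁ eq) with trans (sym (ends-edge₂ e e≢e₂)) eq
  ... | refl = C₂.src e , C₂.tgt e , refl , refl , inj₁ refl
  unlift₂ {e} e≢e₂ (inj₂ eq) with trans (sym (ends-edge₂ e e≢e₂)) eq
  ... | refl = C₂.tgt e , C₂.src e , refl , refl , inj₂ refl

  module Split (Y : Subset (nE G)) (link₁∉Y : lookup Y link₁ ≡ false) (link₂∉Y : lookup Y link₂ ≡ false)
    where
    Y₁ : Subset (nE G₁)
    Y₁ = tabulate (λ e → lookup Y (edge₁ e))
    Y₂ : Subset (nE G₂)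
    Y₂ = tabulate (λ e → lookup Y (edge₂ e))

    avoid₁ : ∀ {e} → lookup Y (edge₁ e) ≡ true → e ≢ e₁
    avoid₁ y refl = true≢false (trans (sym y) link₁∉Y)
    avoid₂ : ∀ {e} → lookup Y (edge₂ e) ≡ true → e ≢ e₂
    avoid₂ y refl = true≢false (trans (sym y) link₂∉Y)

    step-from-ι₁ : ∀ {i w} → C.Step Y (ι₁ i) w → ∃ λ j → w ≡ ι₁ j × C₁.Step Y₁ i j
    step-from-ι₁ (C.step f y fw) with ↑-cases (nE G₁) (nE G₂) f
    ... | inj₁ (e , refl) with unlift₁ (avoid₁ y) fw
    ...   | _ , j , i≡ , refl , ev with ↑ˡ-injective (nV G₂) _ _ i≡
    ...     | refl = j , refl , C₁.step e (trans (lookup∘tabulate _ e) y) ev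
    step-from-ι₁ (C.step f y fw) | inj₂ (e , refl) with unlift₂ (avoid₂ y) fw
    ... | _ , _ , i≡ , _ = contradiction i≡ (↑ˡ≢↑ʳ _ _)

    step-from-ι₂ : ∀ {i w} → C.Step Y (ι₂ i) w → ∃ λ j → w ≡ ι₂ j × C₂.Step Y₂ i j
    step-from-ι₂ (C.step f y fw) with ↑-cases (nE G₁) (nE G₂) f
    ... | inj₂ (e , refl) with unlift₂ (avoid₂ y) fw
    ...   | _ , j , i≡ , refl , ev with ↑ʳ-injective (nV G₁) _ _ i≡
    ...     | refl = j , refl , C₂.step e (trans (lookup∘tabulate _ e) y) ev
    step-from-ι₂ (C.step f y fw) | inj₁ (e , refl) with unlift₁ (avoid₁ y) fw
    ... | _ , _ , i≡ , _ = contradiction (sym i≡) (↑ˡ≢↑ʳ _ _)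

    path-from-ι₁ : ∀ {i w} → C.Path Y (ι₁ i) w → ∃ λ j → w ≡ ι₁ j × C₁.Path Y₁ i j
    path-from-ι₁ {i} ε = i , refl , ε
    path-from-ι₁ (s ◅ p) with step-from-ι₁ s
    ... | _ , refl , s₁ with path-from-ι₁ p
    ...   | j , w≡ , p₁ = j , w≡ , s₁ ◅ p₁

    path-from-ι₂ : ∀ {i w} → C.Path Y (ι₂ i) w → ∃ λ j → w ≡ ι₂ j × C₂.Path Y₂ i j
    path-from-ι₂ {i} ε = i , refl , ε
    path-from-ι₂ (s ◅ p) with step-from-ι₂ s
    ... | _ , refl , s₂ with path-from-ι₂ p
    ...   | j , w≡ , p₂ = j , w≡ , s₂ ◅ p₂

    ¬Path-ι₁ι₂ : ∀ {i j} → ¬ C.Path Y (ι₁ i) (ι₂ j)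
    ¬Path-ι₁ι₂ p with path-from-ι₁ p
    ... | _ , j≡ , _ = ↑ˡ≢↑ʳ _ _ (sym j≡)

    unlift-Path₁ : ∀ {i j} → C.Path Y (ι₁ i) (ι₁ j) → C₁.Path Y₁ i j
    unlift-Path₁ p with path-from-ι₁ p
    ... | _ , j≡ , p₁ with ↑ˡ-injective (nV G₂) _ _ j≡
    ...   | refl = p₁

    unlift-Path₂ : ∀ {i j} → C.Path Y (ι₂ i) (ι₂ j) → C₂.Path Y₂ i j
    unlift-Path₂ p with path-from-ι₂ p
    ... | _ , j≡ , p₂ with ↑ʳ-injective (nV G₁) _ _ j≡
    ...   | refl = p₂

    lift-Path₁ : ∀ {i j} → C₁.Path Y₁ i j → C.Path Y (ι₁ i) (ι₁ j)
    lift-Path₁ = gmap ι₁ λ { (C₁.step e y ev) → let y′ = trans (sym (lookup∘tabulate _ e)) y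
                                                in C.step (edge₁ e) y′ (lift₁ (avoid₁ y′) ev) }

    lift-Path₂ : ∀ {i j} → C₂.Path Y₂ i j → C.Path Y (ι₂ i) (ι₂ j)
    lift-Path₂ = gmap ι₂ λ { (C₂.step e y ev) → let y′ = trans (sym (lookup∘tabulate _ e)) y
                                                in C.step (edge₂ e) y′ (lift₂ (avoid₂ y′) ev) }

    leader-ι₁ : ∀ i → C.leader Y (ι₁ i) ≡ C₁.leader Y₁ i
    leader-ι₁ i = true⇔⇒≡
      (λ h → C₁.IsLeast⇒leader {Y₁} λ u u<i p →
        C.leader⇒IsLeast {Y} h (ι₁ u) (subst₂ _<_ (sym (toℕ-↑ˡ u _)) (sym (toℕ-↑ˡ i _)) u<i) (lift-Path₁ p))
      (λ h → C.IsLeast⇒leader {Y} λ u u<ι₁i p → below (C₁.leader⇒IsLeast {Y₁} h) u<ι₁i p)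
      where
      below : C₁.IsLeast Y₁ i → ∀ {u} → u Fin.< ι₁ i → ¬ C.Path Y u (ι₁ i)
      below least u<ι₁i p with path-from-ι₁ (C.Path-sym p)
      ... | j , refl , p₁ = least j (subst₂ _<_ (toℕ-↑ˡ j _) (toℕ-↑ˡ i _) u<ι₁i) (C₁.Path-sym p₁)

    leader-ι₂ : ∀ i → C.leader Y (ι₂ i) ≡ C₂.leader Y₂ i
    leader-ι₂ i = true⇔⇒≡
      (λ h → C₂.IsLeast⇒leader {Y₂} λ u u<i p →
        C.leader⇒IsLeast {Y} h (ι₂ u) (subst₂ _<_ (sym (toℕ-↑ʳ _ u)) (sym (toℕ-↑ʳ _ i)) (+-monoʳ-< (nV G₁) u<i))
          (lift-Path₂ p))
      (λ h → C.IsLeast⇒leader {Y} λ u u<ι₂i p → below (C₂.leader⇒IsLeast {Y₂} h) u<ι₂i p)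
      where
      below : C₂.IsLeast Y₂ i → ∀ {u} → u Fin.< ι₂ i → ¬ C.Path Y u (ι₂ i)
      below least u<ι₂i p with path-from-ι₂ (C.Path-sym p)
      ... | j , refl , p₂ =
        least j (+-cancelˡ-< (nV G₁) _ _ (subst₂ _<_ (toℕ-↑ʳ _ j) (toℕ-↑ʳ _ i) u<ι₂i)) (C₂.Path-sym p₂)

    components-split : components G Y ≡ components G₁ Y₁ + components G₂ Y₂
    components-split = trans (count-++ (nV G₁) (nV G₂) (C.leader Y))
                             (cong₂ _+_ (count-cong leader-ι₁) (count-cong leader-ι₂))

  module Boundary (A₁ : Subset (nV G₁)) (A₂ : Subset (nV G₂)) where
    A : Subset (nV G)
    A = A₁ ++ A₂

    -- Without both links, N″ is the disjoint union of W₁ and W₂.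
    N N′ N″ : Subset (nE G)
    N = ∁ (δ G A)
    N′ = N - link₂
    N″ = N′ - link₁

    N₁ W₁ : Subset (nE G₁)
    N₁ = ∁ (δ G₁ A₁)
    W₁ = N₁ - e₁
    N₂ W₂ : Subset (nE G₂)
    N₂ = ∁ (δ G₂ A₂)
    W₂ = N₂ - e₂

    δ-edge₁ : ∀ e → e ≢ e₁ → lookup (δ G A) (edge₁ e) ≡ lookup (δ G₁ A₁) e
    δ-edge₁ e e≢e₁ rewrite lookup-δ G A (edge₁ e) | ends-edge₁ e e≢e₁
                         | lookup-++ˡ A₁ A₂ (C₁.src e) | lookup-++ˡ A₁ A₂ (C₁.tgt e) = sym (lookup-δ G₁ A₁ e)
    δ-edge₂ : ∀ e → e ≢ e₂ → lookup (δ G A) (edge₂ e) ≡ lookup (δ G₂ A₂) e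
    δ-edge₂ e e≢e₂ rewrite lookup-δ G A (edge₂ e) | ends-edge₂ e e≢e₂
                         | lookup-++ʳ A₁ A₂ (C₂.src e) | lookup-++ʳ A₁ A₂ (C₂.tgt e) = sym (lookup-δ G₂ A₂ e)
    δ-link₁ : lookup (δ G A) link₁ ≡ lookup A₁ a₁ ∨ lookup A₂ a₂
    δ-link₁ rewrite lookup-δ-EdgeBetween G A (inj₁ ends-link₁) | lookup-++ˡ A₁ A₂ a₁ | lookup-++ʳ A₁ A₂ a₂ = refl
    δ-link₂ : lookup (δ G A) link₂ ≡ lookup A₁ b₁ ∨ lookup A₂ b₂
    δ-link₂ rewrite lookup-δ-EdgeBetween G A (inj₁ ends-link₂) | lookup-++ˡ A₁ A₂ b₁ | lookup-++ʳ A₁ A₂ b₂ = refl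

    link₁≢link₂ : link₁ ≢ link₂
    link₁≢link₂ = ↑ˡ≢↑ʳ e₁ e₂

    link₁∉N″ : lookup N″ link₁ ≡ false
    link₁∉N″ = lookup-─⁅⁆-self N′ link₁
    link₂∉N″ : lookup N″ link₂ ≡ false
    link₂∉N″ = trans (lookup-─⁅⁆-other N′ (link₁≢link₂ ∘ sym)) (lookup-─⁅⁆-self N link₂)

    module S = Split N″ link₁∉N″ link₂∉N″

    N″-edge₁ : ∀ e → e ≢ e₁ → lookup N″ (edge₁ e) ≡ lookup N (edge₁ e)
    N″-edge₁ e e≢e₁ = trans (lookup-─⁅⁆-other N′ (e≢e₁ ∘ ↑ˡ-injective (nE G₂) e e₁))
                            (lookup-─⁅⁆-other N (↑ˡ≢↑ʳ e e₂))
    N″-edge₂ : ∀ e → e ≢ e₂ → lookup N″ (edge₂ e) ≡ lookup N (edge₂ e)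
    N″-edge₂ e e≢e₂ = trans (lookup-─⁅⁆-other N′ (↑ˡ≢↑ʳ e₁ e ∘ sym))
                            (lookup-─⁅⁆-other N (e≢e₂ ∘ ↑ʳ-injective (nE G₁) e e₂))

    restrict₁ : S.Y₁ ≡ W₁
    restrict₁ = vec-ext _ _ λ e → trans (lookup∘tabulate _ e) (case e ≟ e₁ of λ
      { (yes refl) → trans link₁∉N″ (sym (lookup-─⁅⁆-self N₁ e₁))
      ; (no e≢e₁) → begin
          lookup N″ (edge₁ e)           ≡⟨ N″-edge₁ e e≢e₁ ⟩
          lookup N (edge₁ e)            ≡⟨ lookup-∁ (δ G A) (edge₁ e) ⟩
          not (lookup (δ G A) (edge₁ e)) ≡⟨ cong not (δ-edge₁ e e≢e₁) ⟩
          not (lookup (δ G₁ A₁) e)      ≡⟨ sym (lookup-∁ (δ G₁ A₁) e) ⟩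
          lookup N₁ e                   ≡⟨ sym (lookup-─⁅⁆-other N₁ e≢e₁) ⟩
          lookup W₁ e                   ∎ })
      where open ≡-Reasoning

    restrict₂ : S.Y₂ ≡ W₂
    restrict₂ = vec-ext _ _ λ e → trans (lookup∘tabulate _ e) (case e ≟ e₂ of λ
      { (yes refl) → trans link₂∉N″ (sym (lookup-─⁅⁆-self N₂ e₂))
      ; (no e≢e₂) → begin
          lookup N″ (edge₂ e)           ≡⟨ N″-edge₂ e e≢e₂ ⟩
          lookup N (edge₂ e)            ≡⟨ lookup-∁ (δ G A) (edge₂ e) ⟩
          not (lookup (δ G A) (edge₂ e)) ≡⟨ cong not (δ-edge₂ e e≢e₂) ⟩
          not (lookup (δ G₂ A₂) e)      ≡⟨ sym (lookup-∁ (δ G₂ A₂) e) ⟩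
          lookup N₂ e                   ≡⟨ sym (lookup-─⁅⁆-other N₂ e≢e₂) ⟩
          lookup W₂ e                   ∎ })
      where open ≡-Reasoning

    unlift-W₁ : ∀ {i j} → C.Path N″ (ι₁ i) (ι₁ j) → C₁.Path W₁ i j
    unlift-W₁ {i} {j} p = subst (λ Z → C₁.Path Z i j) restrict₁ (S.unlift-Path₁ p)
    unlift-W₂ : ∀ {i j} → C.Path N″ (ι₂ i) (ι₂ j) → C₂.Path W₂ i j
    unlift-W₂ {i} {j} p = subst (λ Z → C₂.Path Z i j) restrict₂ (S.unlift-Path₂ p)
    lift-W₁ : ∀ {i j} → C₁.Path W₁ i j → C.Path N″ (ι₁ i) (ι₁ j)
    lift-W₁ {i} {j} p = S.lift-Path₁ (subst (λ Z → C₁.Path Z i j) (sym restrict₁) p)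
    lift-W₂ : ∀ {i j} → C₂.Path W₂ i j → C.Path N″ (ι₂ i) (ι₂ j)
    lift-W₂ {i} {j} p = S.lift-Path₂ (subst (λ Z → C₂.Path Z i j) (sym restrict₂) p)

    components-N″ : components G N″ ≡ components G₁ W₁ + components G₂ W₂
    components-N″ = trans S.components-split
                          (cong₂ _+_ (cong (components G₁) restrict₁) (cong (components G₂) restrict₂))

    cn₁ cn₂ P Q : Bool
    cn₁ = connectedIn G₁ W₁ a₁ b₁
    cn₂ = connectedIn G₂ W₂ a₂ b₂
    P = lookup N link₁
    Q = lookup N link₂

    P′ : lookup N′ link₁ ≡ P
    P′ = lookup-─⁅⁆-other N link₁≢link₂

    components-N′ : components G N′ + bit P ≡ components G N″
    components-N′ = trans (cong (λ b → components G N′ + bit b) (sym P∧¬crossing))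
                          (C.components-─ N′ (inj₁ ends-link₁))
      where
      no-crossing : connectedIn G N″ (ι₁ a₁) (ι₂ a₂) ≡ false
      no-crossing = ¬-not λ h → S.¬Path-ι₁ι₂ (C.connectedIn⇒Path h)
      P∧¬crossing : lookup N′ link₁ ∧ not (connectedIn G N″ (ι₁ a₁) (ι₂ a₂)) ≡ P
      P∧¬crossing rewrite P′ | no-crossing = ∧-identityʳ P

    -- Once link₂ is removed, link₁ is the only edge between the two sides.
    crossing : connectedIn G N′ (ι₁ b₁) (ι₂ b₂) ≡ P ∧ (cn₁ ∧ cn₂)
    crossing with P in link₁∈N
    ... | false = ¬-not λ h →
      S.¬Path-ι₁ι₂ (subst (λ Z → C.Path Z _ _) (sym (─⁅⁆-absent N′ (trans P′ link₁∈N))) (C.connectedIn⇒Path h))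
    ... | true = true⇔⇒≡ to from
      where
      open C.AddEdge N″ N′ link₁ (trans P′ link₁∈N) (λ f f≢link₁ → sym (lookup-─⁅⁆-other N′ f≢link₁))
        using (Path⁺⇒Via; Via⇒Path⁺)
      src≡ : C.src link₁ ≡ ι₁ a₁
      src≡ = cong proj₁ ends-link₁
      tgt≡ : C.tgt link₁ ≡ ι₂ a₂
      tgt≡ = cong proj₂ ends-link₁
      to : connectedIn G N′ (ι₁ b₁) (ι₂ b₂) ≡ true → cn₁ ∧ cn₂ ≡ true
      to h with Path⁺⇒Via (C.connectedIn⇒Path h)
      ... | inj₁ p = contradiction p S.¬Path-ι₁ι₂
      ... | inj₂ (inj₁ (p , q)) =
        ∧-true⇐ (C₁.Path⇒connectedIn (C₁.Path-sym (unlift-W₁ (subst (C.Path N″ _) src≡ p))))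
                (C₂.Path⇒connectedIn (unlift-W₂ (subst (λ z → C.Path N″ z _) tgt≡ q)))
      ... | inj₂ (inj₂ (p , _)) = contradiction (subst (C.Path N″ _) tgt≡ p) S.¬Path-ι₁ι₂
      from : cn₁ ∧ cn₂ ≡ true → connectedIn G N′ (ι₁ b₁) (ι₂ b₂) ≡ true
      from h with ∧-true⇒ cn₁ cn₂ h
      ... | h₁ , h₂ = C.Path⇒connectedIn (Via⇒Path⁺ (inj₂ (inj₁
        ( subst (C.Path N″ _) (sym src≡) (lift-W₁ (C₁.Path-sym (C₁.connectedIn⇒Path h₁)))
        , subst (λ z → C.Path N″ z _) (sym tgt≡) (lift-W₂ (C₂.connectedIn⇒Path h₂))))))

    link-merges : ℕ
    link-merges = bit (Q ∧ not (P ∧ (cn₁ ∧ cn₂))) + bit P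

    components-N : components G N + link-merges ≡ components G₁ W₁ + components G₂ W₂
    components-N = begin
      components G N + (bit (Q ∧ not (P ∧ (cn₁ ∧ cn₂))) + bit P) ≡⟨ sym (+-assoc (components G N) _ _) ⟩
      components G N + bit (Q ∧ not (P ∧ (cn₁ ∧ cn₂))) + bit P   ≡⟨ cong (_+ bit P) remove-link₂ ⟩
      components G N′ + bit P                                    ≡⟨ components-N′ ⟩
      components G N″                                            ≡⟨ components-N″ ⟩
      components G₁ W₁ + components G₂ W₂                        ∎
      where
      open ≡-Reasoning
      remove-link₂ : components G N + bit (Q ∧ not (P ∧ (cn₁ ∧ cn₂))) ≡ components G N′
      remove-link₂ = subst (λ c → components G N + bit (Q ∧ not c) ≡ components G N′) crossing
                           (C.components-─ N (inj₁ ends-link₂))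

    δ-count₁ δ-count₂ : ℕ
    δ-count₁ = count (λ e → lookup (δ G A) (edge₁ e))
    δ-count₂ = count (λ e → lookup (δ G A) (edge₂ e))

    size-δ : ∣ δ G A ∣ ≡ δ-count₁ + δ-count₂
    size-δ = trans (∣p∣≡count (δ G A)) (count-++ (nE G₁) (nE G₂) (lookup (δ G A)))

    size-δ₁ : δ-count₁ + bit (lookup (δ G₁ A₁) e₁) ≡ ∣ δ G₁ A₁ ∣ + bit (lookup (δ G A) link₁)
    size-δ₁ = trans (count-agreeOff _ (lookup (δ G₁ A₁)) e₁ δ-edge₁)
                    (cong (_+ bit (lookup (δ G A) link₁)) (sym (∣p∣≡count (δ G₁ A₁))))
    size-δ₂ : δ-count₂ + bit (lookup (δ G₂ A₂) e₂) ≡ ∣ δ G₂ A₂ ∣ + bit (lookup (δ G A) link₂)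
    size-δ₂ = trans (count-agreeOff _ (lookup (δ G₂ A₂)) e₂ δ-edge₂)
                    (cong (_+ bit (lookup (δ G A) link₂)) (sym (∣p∣≡count (δ G₂ A₂))))

∸-≤⇔ : ∀ x a c c′ n → c ≤ n → c′ ≤ n → ((x + (n ∸ c)) ∸ (n ∸ c′) ≤ a ⇔ x + c′ ≤ a + c)
∸-≤⇔ x a c c′ n c≤n c′≤n = mk⇔ to from
  where
  p q : ℕ
  p = n ∸ c
  q = n ∸ c′
  p+c : p + c ≡ n
  p+c = m∸n+n≡m c≤n
  q+c′ : q + c′ ≡ n
  q+c′ = m∸n+n≡m c′≤n
  regroupˡ : ∀ x c′ p c → x + c′ + (p + c) ≡ (x + p) + (c′ + c)
  regroupˡ = solve-∀
  regroupʳ : ∀ a c q c′ → a + c + (q + c′) ≡ (q + a) + (c′ + c)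
  regroupʳ = solve-∀
  to : (x + p) ∸ q ≤ a → x + c′ ≤ a + c
  to h = +-cancelʳ-≤ n _ _ (subst₂ _≤_ (trans (sym (regroupˡ x c′ p c)) (cong (x + c′ +_) p+c))
                                       (trans (sym (regroupʳ a c q c′)) (cong (a + c +_) q+c′))
                                       (+-monoˡ-≤ (c′ + c) (≤-trans (m≤n+m∸n (x + p) q) (+-monoʳ-≤ q h))))
  from : x + c′ ≤ a + c → (x + p) ∸ q ≤ a
  from h = m≤n+o⇒m∸n≤o (x + p) q (+-cancelʳ-≤ (c′ + c) _ _
             (subst₂ _≤_ (trans (cong (x + c′ +_) (sym p+c)) (regroupˡ x c′ p c))
                         (trans (cong (a + c +_) (sym q+c′)) (regroupʳ a c q c′))
                         (+-monoˡ-≤ n h)))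

Dependent⇔ : ∀ H A → Dependent H A ⇔ (∣ δ H A ∣ + components H ⊤ ≤ ∣ A ∣ + components H (∁ (δ H A)))
Dependent⇔ H A =
  ∸-≤⇔ ∣ δ H A ∣ ∣ A ∣ (components H (∁ (δ H A))) (components H ⊤) (nV H) (count≤ _) (count≤ _)

Dependent⇔-connected : ∀ H A → components H ⊤ ≡ 1 →
                       Dependent H A ⇔ (∣ δ H A ∣ + 1 ≤ ∣ A ∣ + components H (∁ (δ H A)))
Dependent⇔-connected H A c⊤ =
  subst (λ c → Dependent H A ⇔ (∣ δ H A ∣ + c ≤ ∣ A ∣ + components H (∁ (δ H A)))) c⊤ (Dependent⇔ H A)

≤-suc-+-split : ∀ x₁ x₂ y₁ y₂ → x₁ + x₂ ≤ suc (y₁ + y₂) → x₁ ≤ y₁ ⊎ x₂ ≤ y₂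
≤-suc-+-split x₁ x₂ y₁ y₂ h with x₁ ≤? y₁
... | yes x₁≤y₁ = inj₁ x₁≤y₁
... | no x₁≰y₁ = inj₂ (+-cancelˡ-≤ (suc y₁) _ _ (≤-trans (+-monoˡ-≤ x₂ (≰⇒> x₁≰y₁)) h))

-- dᵢ = |δᵢ Aᵢ| and dL + dR = |δ A|; tᵢ, α, β record whether eᵢ, link₁, link₂ meet A;
-- k, kᵢ count the components of the complements of δ, and sᵢ, M the changes caused by
-- deleting eᵢ, respectively the two links.
dependence-splits : ∀ dL dR d₁ d₂ t₁ t₂ α β k M k₁ k₂ s₁ s₂ a₁ a₂ →
  dL + t₁ ≡ d₁ + α → dR + t₂ ≡ d₂ + β → k + M ≡ (k₁ + s₁) + (k₂ + s₂) →
  t₁ + t₂ + s₁ + s₂ ≤ α + β + M → dL + dR + 1 ≤ a₁ + a₂ + k →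
  d₁ + 1 ≤ a₁ + k₁ ⊎ d₂ + 1 ≤ a₂ + k₂
dependence-splits dL dR d₁ d₂ t₁ t₂ α β k M k₁ k₂ s₁ s₂ a₁ a₂ sizeˡ sizeʳ comps boundary dep =
  ≤-suc-+-split (d₁ + 1) (d₂ + 1) (a₁ + k₁) (a₂ + k₂) (+-cancelʳ-≤ K _ _ sum)
  where
  open ≤-Reasoning
  K : ℕ
  K = α + β + (s₁ + s₂ + M)
  r₁ : ∀ d₁ d₂ α β s₁ s₂ M →
       d₁ + 1 + (d₂ + 1) + (α + β + (s₁ + s₂ + M)) ≡ (d₁ + α) + (d₂ + β) + 2 + (s₁ + s₂ + M)
  r₁ = solve-∀
  r₂ : ∀ dL dR t₁ t₂ s₁ s₂ M →
       (dL + t₁) + (dR + t₂) + 2 + (s₁ + s₂ + M) ≡ (dL + dR + 1) + 1 + (t₁ + t₂ + s₁ + s₂) + M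
  r₂ = solve-∀
  r₃ : ∀ a₁ a₂ k α β M → (a₁ + a₂ + k) + 1 + (α + β + M) + M ≡ a₁ + a₂ + 1 + α + β + M + (k + M)
  r₃ = solve-∀
  r₄ : ∀ a₁ a₂ k₁ k₂ α β s₁ s₂ M →
       a₁ + a₂ + 1 + α + β + M + ((k₁ + s₁) + (k₂ + s₂)) ≡ suc (a₁ + k₁ + (a₂ + k₂)) + (α + β + (s₁ + s₂ + M))
  r₄ = solve-∀
  sum : d₁ + 1 + (d₂ + 1) + K ≤ suc (a₁ + k₁ + (a₂ + k₂)) + K
  sum = begin
    d₁ + 1 + (d₂ + 1) + K                              ≡⟨ r₁ d₁ d₂ α β s₁ s₂ M ⟩
    (d₁ + α) + (d₂ + β) + 2 + (s₁ + s₂ + M)            ≡⟨ cong₂ (λ u v → u + v + 2 + (s₁ + s₂ + M)) (sym sizeˡ) (sym sizeʳ) ⟩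
    (dL + t₁) + (dR + t₂) + 2 + (s₁ + s₂ + M)          ≡⟨ r₂ dL dR t₁ t₂ s₁ s₂ M ⟩
    (dL + dR + 1) + 1 + (t₁ + t₂ + s₁ + s₂) + M        ≤⟨ +-monoˡ-≤ M (+-mono-≤ (+-monoˡ-≤ 1 dep) boundary) ⟩
    (a₁ + a₂ + k) + 1 + (α + β + M) + M                ≡⟨ r₃ a₁ a₂ k α β M ⟩
    a₁ + a₂ + 1 + α + β + M + (k + M)                  ≡⟨ cong (a₁ + a₂ + 1 + α + β + M +_) comps ⟩
    a₁ + a₂ + 1 + α + β + M + ((k₁ + s₁) + (k₂ + s₂))  ≡⟨ r₄ a₁ a₂ k₁ k₂ α β s₁ s₂ M ⟩
    suc (a₁ + k₁ + (a₂ + k₂)) + K                      ∎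

-- The case A₂ = ∅ of the above; w records whether both ends of e₁ lie in A₁.
dependence-one-sided : ∀ dL dR d₁ t₁ α β w k M k₁ s₁ a₁ →
  dL + t₁ ≡ d₁ + α → dR ≡ β → α + β ≡ w + t₁ → k + M ≡ (k₁ + s₁) + 1 → s₁ + 1 ≡ w + M →
  (dL + dR + 1 ≤ a₁ + 0 + k ⇔ d₁ + 1 ≤ a₁ + k₁)
dependence-one-sided dL dR d₁ t₁ α β w k M k₁ s₁ a₁ sizeˡ sizeʳ links comps bridge =
  mk⇔ (λ h → +-cancelʳ-≤ w _ _ (subst₂ _≤_ lhs≡ rhs≡ h))
      (λ h → subst₂ _≤_ (sym lhs≡) (sym rhs≡) (+-monoˡ-≤ w h))
  where
  r₁ : ∀ dL dR t₁ → dL + dR + t₁ ≡ (dL + t₁) + dR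
  r₁ = solve-∀
  r₂ : ∀ d w → d + w + 1 ≡ d + 1 + w
  r₂ = solve-∀
  r₃ : ∀ a k w → a + 0 + (k + w) ≡ a + k + w
  r₃ = solve-∀
  size≡ : dL + dR ≡ d₁ + w
  size≡ = +-cancelʳ-≡ t₁ _ _ (begin
    dL + dR + t₁       ≡⟨ r₁ dL dR t₁ ⟩
    (dL + t₁) + dR     ≡⟨ cong₂ _+_ sizeˡ sizeʳ ⟩
    d₁ + α + β         ≡⟨ +-assoc d₁ α β ⟩
    d₁ + (α + β)       ≡⟨ cong (d₁ +_) links ⟩
    d₁ + (w + t₁)      ≡⟨ sym (+-assoc d₁ w t₁) ⟩
    d₁ + w + t₁        ∎)
    where open ≡-Reasoning
  comps≡ : k ≡ k₁ + w
  comps≡ = +-cancelʳ-≡ M _ _ (begin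
    k + M              ≡⟨ comps ⟩
    k₁ + s₁ + 1        ≡⟨ +-assoc k₁ s₁ 1 ⟩
    k₁ + (s₁ + 1)      ≡⟨ cong (k₁ +_) bridge ⟩
    k₁ + (w + M)       ≡⟨ sym (+-assoc k₁ w M) ⟩
    k₁ + w + M         ∎)
    where open ≡-Reasoning
  lhs≡ : dL + dR + 1 ≡ d₁ + 1 + w
  lhs≡ = trans (cong (_+ 1) size≡) (r₂ d₁ w)
  rhs≡ : a₁ + 0 + k ≡ a₁ + k₁ + w
  rhs≡ = trans (cong (a₁ + 0 +_) comps≡) (r₃ a₁ k₁ w)

bit-∧-∨ : ∀ x y → bit x + bit y ≡ bit (x ∧ y) + bit (x ∨ y)
bit-∧-∨ true true = refl
bit-∧-∨ true false = refl
bit-∧-∨ false true = refl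
bit-∧-∨ false false = refl

one-sided-bridge : ∀ x y c →
  bit (not (x ∨ y) ∧ not c) + 1 ≡ bit (x ∧ y) + (bit (not y ∧ not (not x ∧ c)) + bit (not x))
one-sided-bridge true true c = refl
one-sided-bridge true false c = refl
one-sided-bridge false true c = refl
one-sided-bridge false false true = refl
one-sided-bridge false false false = refl

allTuples : ∀ n → (Vec Bool n → Bool) → Bool
allTuples zero p = p []
allTuples (suc n) p = allTuples n (p ∘ (false ∷_)) ∧ allTuples n (p ∘ (true ∷_))

allTuples-sound : ∀ n p → T (allTuples n p) → ∀ v → T (p v)
allTuples-sound zero p h [] = h
allTuples-sound (suc n) p h (false ∷ v) = allTuples-sound n _ (proj₁ (Equivalence.to T-∧ h)) v
allTuples-sound (suc n) p h (true ∷ v) = allTuples-sound n _ (proj₂ (Equivalence.to T-∧ h)) v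

-- xa₁ xb₁ xa₂ xb₂ record whether a₁ b₁ a₂ b₂ lie in A, and cᵢ whether aᵢ and bᵢ stay
-- connected in Nᵢ − eᵢ; checked by evaluation at all 64 arguments.
boundary-inequality : ∀ xa₁ xb₁ xa₂ xb₂ c₁ c₂ →
  bit (xa₁ ∨ xb₁) + bit (xa₂ ∨ xb₂) + bit (not (xa₁ ∨ xb₁) ∧ not c₁) + bit (not (xa₂ ∨ xb₂) ∧ not c₂)
    ≤ bit (xa₁ ∨ xa₂) + bit (xb₁ ∨ xb₂)
      + (bit (not (xb₁ ∨ xb₂) ∧ not (not (xa₁ ∨ xa₂) ∧ (c₁ ∧ c₂))) + bit (not (xa₁ ∨ xa₂)))
boundary-inequality xa₁ xb₁ xa₂ xb₂ c₁ c₂ =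
  ≤ᵇ⇒≤ _ _ (allTuples-sound 6 holds _ (xa₁ ∷ xb₁ ∷ xa₂ ∷ xb₂ ∷ c₁ ∷ c₂ ∷ []))
  where
  holds : Vec Bool 6 → Bool
  holds (xa₁ ∷ xb₁ ∷ xa₂ ∷ xb₂ ∷ c₁ ∷ c₂ ∷ []) =
    bit (xa₁ ∨ xb₁) + bit (xa₂ ∨ xb₂) + bit (not (xa₁ ∨ xb₁) ∧ not c₁) + bit (not (xa₂ ∨ xb₂) ∧ not c₂)
      ≤ᵇ bit (xa₁ ∨ xa₂) + bit (xb₁ ∨ xb₂)
         + (bit (not (xb₁ ∨ xb₂) ∧ not (not (xa₁ ∨ xa₂) ∧ (c₁ ∧ c₂))) + bit (not (xa₁ ∨ xa₂)))

module Transfer (G₁ G₂ : Graph) (tec₁ : TwoEdgeConnected G₁) (tec₂ : TwoEdgeConnected G₂)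
                (e₁ : Fin (nE G₁)) (a₁ b₁ : Fin (nV G₁)) (eb₁ : EdgeBetween G₁ e₁ a₁ b₁)
                (e₂ : Fin (nE G₂)) (a₂ b₂ : Fin (nV G₂)) (eb₂ : EdgeBetween G₂ e₂ a₂ b₂) where
  open Glue G₁ G₂ e₁ e₂ a₁ b₁ a₂ b₂

  components₁-⊤ : components G₁ ⊤ ≡ 1
  components₁-⊤ = C₁.components-connected ⊤ (proj₁ tec₁) a₁
  components₂-⊤ : components G₂ ⊤ ≡ 1
  components₂-⊤ = C₂.components-connected ⊤ (proj₁ tec₂) a₂

  connected₁-∅ : ∀ u v → connectedIn G₁ (∁ (δ G₁ ∅) - e₁) u v ≡ true
  connected₁-∅ u v = subst (λ Y → connectedIn G₁ Y u v ≡ true)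
                           (sym (trans (cong (_- e₁) (∁δ∅≡⊤ G₁)) (⊤-─⁅⁆ e₁))) (proj₂ tec₁ e₁ u v)
  connected₂-∅ : ∀ u v → connectedIn G₂ (∁ (δ G₂ ∅) - e₂) u v ≡ true
  connected₂-∅ u v = subst (λ Y → connectedIn G₂ Y u v ≡ true)
                           (sym (trans (cong (_- e₂) (∁δ∅≡⊤ G₂)) (⊤-─⁅⁆ e₂))) (proj₂ tec₂ e₂ u v)

  components-⊤ : components G ⊤ ≡ 1
  components-⊤ = begin
    components G ⊤   ≡⟨ cong (components G) (sym N≡⊤) ⟩
    components G B.N ≡⟨ +-cancelʳ-≡ 1 _ _ (trans (cong (components G B.N +_) (sym excess))
                                                   (trans B.components-N two)) ⟩
    1                ∎
    where
    open ≡-Reasoning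
    module B = Boundary ∅ ∅
    N≡⊤ : B.N ≡ ⊤
    N≡⊤ = trans (cong (λ A → ∁ (δ G A)) (∅++∅ (nV G₁) (nV G₂))) (∁δ∅≡⊤ G)
    link∈N : ∀ f → lookup B.N f ≡ true
    link∈N f = trans (cong (λ Y → lookup Y f) N≡⊤) (lookup-replicate f true)
    excess : B.link-merges ≡ 1
    excess rewrite link∈N link₁ | link∈N link₂ | connected₁-∅ a₁ b₁ | connected₂-∅ a₂ b₂ = refl
    two : components G₁ B.W₁ + components G₂ B.W₂ ≡ 1 + 1
    two = cong₂ _+_ (C₁.components-connected _ connected₁-∅ a₁) (C₂.components-connected _ connected₂-∅ a₂)

  dependent-left : ∀ A₁ → Dependent G (A₁ ++ ∅) ⇔ Dependent G₁ A₁
  dependent-left A₁ = begin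
      Dependent G (A₁ ++ ∅)
    ∼⟨ Dependent⇔-connected G (A₁ ++ ∅) components-⊤ ⟩
      ∣ δ G (A₁ ++ ∅) ∣ + 1 ≤ ∣ A₁ ++ ∅ ∣ + components G B.N
    ≡⟨ cong₂ (λ d a → d + 1 ≤ a + components G B.N) B.size-δ
             (trans (∣++∣ A₁ ∅) (cong (∣ A₁ ∣ +_) (∣⊥∣≡0 (nV G₂)))) ⟩
      B.δ-count₁ + B.δ-count₂ + 1 ≤ ∣ A₁ ∣ + 0 + components G B.N
    ∼⟨ dependence-one-sided B.δ-count₁ B.δ-count₂ (∣ δ G₁ A₁ ∣) t α β w (components G B.N) M
                            (components G₁ B.N₁) s (∣ A₁ ∣) B.size-δ₁ sizeʳ links comps bridge ⟩
      ∣ δ G₁ A₁ ∣ + 1 ≤ ∣ A₁ ∣ + components G₁ B.N₁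
    ∼⟨ ⇔-sym (Dependent⇔-connected G₁ A₁ components₁-⊤) ⟩
      Dependent G₁ A₁ ∎
    where
    open EquationalReasoning
    module B = Boundary A₁ ∅
    xa xb : Bool
    xa = lookup A₁ a₁
    xb = lookup A₁ b₁
    t α β w M s : ℕ
    t = bit (lookup (δ G₁ A₁) e₁)
    α = bit (lookup (δ G B.A) link₁)
    β = bit (lookup (δ G B.A) link₂)
    w = bit (xa ∧ xb)
    M = B.link-merges
    s = bit (lookup B.N₁ e₁ ∧ not B.cn₁)
    sizeʳ : B.δ-count₂ ≡ β
    sizeʳ = trans (sym (+-identityʳ _)) (trans (cong (λ b → B.δ-count₂ + bit b) (sym (δ-∅ G₂ e₂)))
                  (trans B.size-δ₂ (cong (_+ β) (∣δ-∅∣ G₂))))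
    links : α + β ≡ w + t
    links rewrite B.δ-link₁ | B.δ-link₂ | lookup-∅ a₂ | lookup-∅ b₂ | ∨-identityʳ xa | ∨-identityʳ xb
                | lookup-δ-EdgeBetween G₁ A₁ eb₁ = bit-∧-∨ xa xb
    comps : components G B.N + M ≡ (components G₁ B.N₁ + s) + 1
    comps = trans B.components-N
                  (cong₂ _+_ (sym (C₁.components-─ B.N₁ eb₁)) (C₂.components-connected _ connected₂-∅ a₂))
    bridge : s + 1 ≡ w + M
    bridge rewrite lookup-∁ (δ G₁ A₁) e₁ | lookup-δ-EdgeBetween G₁ A₁ eb₁
                 | lookup-∁ (δ G B.A) link₁ | lookup-∁ (δ G B.A) link₂ | B.δ-link₁ | B.δ-link₂
                 | lookup-∅ a₂ | lookup-∅ b₂ | ∨-identityʳ xa | ∨-identityʳ xb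
                 | connected₂-∅ a₂ b₂ | ∧-identityʳ B.cn₁ = one-sided-bridge xa xb B.cn₁

  dependent-right : ∀ A₂ → Dependent G (∅ {nV G₁} ++ A₂) ⇔ Dependent G₂ A₂
  dependent-right A₂ = begin
      Dependent G (∅ {nV G₁} ++ A₂)
    ∼⟨ Dependent⇔-connected G (∅ {nV G₁} ++ A₂) components-⊤ ⟩
      ∣ δ G (∅ {nV G₁} ++ A₂) ∣ + 1 ≤ ∣ ∅ {nV G₁} ++ A₂ ∣ + components G B.N
    ≡⟨ cong₂ (λ d a → d + 1 ≤ a + components G B.N) (trans B.size-δ (+-comm B.δ-count₁ B.δ-count₂))
             (trans (∣++∣ (∅ {nV G₁}) A₂) (trans (cong (_+ ∣ A₂ ∣) (∣⊥∣≡0 (nV G₁))) (sym (+-identityʳ _)))) ⟩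
      B.δ-count₂ + B.δ-count₁ + 1 ≤ ∣ A₂ ∣ + 0 + components G B.N
    ∼⟨ dependence-one-sided B.δ-count₂ B.δ-count₁ (∣ δ G₂ A₂ ∣) t β α w (components G B.N) M
                            (components G₂ B.N₂) s (∣ A₂ ∣) B.size-δ₂ sizeˡ links comps bridge ⟩
      ∣ δ G₂ A₂ ∣ + 1 ≤ ∣ A₂ ∣ + components G₂ B.N₂
    ∼⟨ ⇔-sym (Dependent⇔-connected G₂ A₂ components₂-⊤) ⟩
      Dependent G₂ A₂ ∎
    where
    open EquationalReasoning
    module B = Boundary ∅ A₂
    xa xb : Bool
    xa = lookup A₂ a₂
    xb = lookup A₂ b₂
    t α β w M s : ℕ
    t = bit (lookup (δ G₂ A₂) e₂)
    α = bit (lookup (δ G B.A) link₁)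
    β = bit (lookup (δ G B.A) link₂)
    w = bit (xa ∧ xb)
    M = B.link-merges
    s = bit (lookup B.N₂ e₂ ∧ not B.cn₂)
    sizeˡ : B.δ-count₁ ≡ α
    sizeˡ = trans (sym (+-identityʳ _)) (trans (cong (λ b → B.δ-count₁ + bit b) (sym (δ-∅ G₁ e₁)))
                  (trans B.size-δ₁ (cong (_+ α) (∣δ-∅∣ G₁))))
    links : β + α ≡ w + t
    links = trans (+-comm β α) links′
      where
      links′ : α + β ≡ w + t
      links′ rewrite B.δ-link₁ | B.δ-link₂ | lookup-∅ a₁ | lookup-∅ b₁
                   | lookup-δ-EdgeBetween G₂ A₂ eb₂ = bit-∧-∨ xa xb
    comps : components G B.N + M ≡ (components G₂ B.N₂ + s) + 1
    comps = trans B.components-N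
                  (trans (cong₂ _+_ (C₁.components-connected _ connected₁-∅ a₁) (sym (C₂.components-─ B.N₂ eb₂)))
                         (+-comm 1 _))
    bridge : s + 1 ≡ w + M
    bridge rewrite lookup-∁ (δ G₂ A₂) e₂ | lookup-δ-EdgeBetween G₂ A₂ eb₂
                 | lookup-∁ (δ G B.A) link₁ | lookup-∁ (δ G B.A) link₂ | B.δ-link₁ | B.δ-link₂
                 | lookup-∅ a₁ | lookup-∅ b₁ | connected₁-∅ a₁ b₁ = one-sided-bridge xa xb B.cn₂

  dependent-split : ∀ A₁ A₂ → Dependent G (A₁ ++ A₂) → Dependent G₁ A₁ ⊎ Dependent G₂ A₂
  dependent-split A₁ A₂ dep =
    Sum.map (Equivalence.from (Dependent⇔-connected G₁ A₁ components₁-⊤))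
            (Equivalence.from (Dependent⇔-connected G₂ A₂ components₂-⊤))
            (dependence-splits B.δ-count₁ B.δ-count₂ (∣ δ G₁ A₁ ∣) (∣ δ G₂ A₂ ∣) t₁ t₂ α β (components G B.N) M
                               (components G₁ B.N₁) (components G₂ B.N₂) s₁ s₂ (∣ A₁ ∣) (∣ A₂ ∣)
                               B.size-δ₁ B.size-δ₂ comps boundary dep′)
    where
    module B = Boundary A₁ A₂
    t₁ t₂ α β M s₁ s₂ : ℕ
    t₁ = bit (lookup (δ G₁ A₁) e₁)
    t₂ = bit (lookup (δ G₂ A₂) e₂)
    α = bit (lookup (δ G B.A) link₁)
    β = bit (lookup (δ G B.A) link₂)
    M = B.link-merges
    s₁ = bit (lookup B.N₁ e₁ ∧ not B.cn₁)
    s₂ = bit (lookup B.N₂ e₂ ∧ not B.cn₂)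
    comps : components G B.N + M ≡ (components G₁ B.N₁ + s₁) + (components G₂ B.N₂ + s₂)
    comps = trans B.components-N (cong₂ _+_ (sym (C₁.components-─ B.N₁ eb₁)) (sym (C₂.components-─ B.N₂ eb₂)))
    dep′ : B.δ-count₁ + B.δ-count₂ + 1 ≤ ∣ A₁ ∣ + ∣ A₂ ∣ + components G B.N
    dep′ = subst₂ _≤_ (cong (_+ 1) B.size-δ) (cong (_+ components G B.N) (∣++∣ A₁ A₂))
                  (Equivalence.to (Dependent⇔-connected G B.A components-⊤) dep)
    boundary : t₁ + t₂ + s₁ + s₂ ≤ α + β + M
    boundary rewrite lookup-∁ (δ G₁ A₁) e₁ | lookup-∁ (δ G₂ A₂) e₂
                   | lookup-δ-EdgeBetween G₁ A₁ eb₁ | lookup-δ-EdgeBetween G₂ A₂ eb₂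
                   | lookup-∁ (δ G B.A) link₁ | lookup-∁ (δ G B.A) link₂ | B.δ-link₁ | B.δ-link₂ =
      boundary-inequality (lookup A₁ a₁) (lookup A₁ b₁) (lookup A₂ a₂) (lookup A₂ b₂) B.cn₁ B.cn₂

Circuit : ∀ {k} → (Subset k → Set) → Subset k → Set
Circuit D A = Nonempty A × D A × (∀ B → Nonempty B → B ⊆ A → D B → B ≡ A)

module DirectSum {n₁ n₂} (D : Subset (n₁ + n₂) → Set) (D₁ : Subset n₁ → Set) (D₂ : Subset n₂ → Set)
                 (left : ∀ A₁ → D (A₁ ++ ∅) ⇔ D₁ A₁) (right : ∀ A₂ → D (∅ ++ A₂) ⇔ D₂ A₂)
                 (split : ∀ A₁ A₂ → D (A₁ ++ A₂) → D₁ A₁ ⊎ D₂ A₂) where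

  circuit-one-sided : ∀ A₁ A₂ → Circuit D (A₁ ++ A₂) → A₁ ≡ ∅ ⊎ A₂ ≡ ∅
  circuit-one-sided A₁ A₂ (_ , dep , minimal) with nonempty? A₁ | nonempty? A₂
  ... | no A₁-empty | _ = inj₁ (Empty-unique A₁-empty)
  ... | yes _ | no A₂-empty = inj₂ (Empty-unique A₂-empty)
  ... | yes ne₁ | yes ne₂ with split A₁ A₂ dep
  ...   | inj₁ d₁ = contradiction (subst Nonempty (sym ∅≡A₂) ne₂) ¬Nonempty-∅
    where
    ∅≡A₂ : ∅ ≡ A₂
    ∅≡A₂ = ++-injectiveʳ A₁ A₁ (minimal (A₁ ++ ∅) (Nonempty-++ˡ ∅ ne₁) (⊆-++⁺ {p = A₁} {A₁} {∅} {A₂} ⊆-refl ⊥⊆)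
                                        (Equivalence.from (left A₁) d₁))
  ...   | inj₂ d₂ = contradiction (subst Nonempty (sym ∅≡A₁) ne₁) ¬Nonempty-∅
    where
    ∅≡A₁ : ∅ ≡ A₁
    ∅≡A₁ = ++-injectiveˡ ∅ A₁ (minimal (∅ ++ A₂) (Nonempty-++ʳ ∅ ne₂) (⊆-++⁺ {p = ∅} {A₁} {A₂} {A₂} ⊥⊆ ⊆-refl)
                                       (Equivalence.from (right A₂) d₂))

  circuit-left : ∀ A₁ → Circuit D (A₁ ++ ∅) ⇔ Circuit D₁ A₁
  circuit-left A₁ = mk⇔ to from
    where
    to : Circuit D (A₁ ++ ∅) → Circuit D₁ A₁
    to (ne , dep , minimal) = ne₁ , Equivalence.to (left A₁) dep , minimal₁
      where
      ne₁ : Nonempty A₁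
      ne₁ = Sum.[ id , (λ ne∅ → contradiction ne∅ ¬Nonempty-∅) ] (Nonempty-++⁻ A₁ ∅ ne)
      minimal₁ : ∀ B → Nonempty B → B ⊆ A₁ → D₁ B → B ≡ A₁
      minimal₁ B neB B⊆A₁ dB =
        ++-injectiveˡ B A₁ (minimal (B ++ ∅) (Nonempty-++ˡ ∅ neB) (⊆-++⁺ B⊆A₁ ⊆-refl) (Equivalence.from (left B) dB))
    from : Circuit D₁ A₁ → Circuit D (A₁ ++ ∅)
    from (ne₁ , d₁ , minimal₁) = Nonempty-++ˡ ∅ ne₁ , Equivalence.from (left A₁) d₁ , minimal
      where
      minimal : ∀ B → Nonempty B → B ⊆ A₁ ++ ∅ → D B → B ≡ A₁ ++ ∅
      minimal B neB B⊆ dB with Vec.splitAt n₁ B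
      ... | B₁ , B₂ , refl with ⊆∅⇒≡∅ (⊆-++⁻ʳ {p = B₁} B⊆)
      ... | refl = cong (_++ ∅) (minimal₁ B₁ neB₁ (⊆-++⁻ˡ B⊆) (Equivalence.to (left B₁) dB))
        where
        neB₁ : Nonempty B₁
        neB₁ = Sum.[ id , (λ ne∅ → contradiction ne∅ ¬Nonempty-∅) ] (Nonempty-++⁻ B₁ ∅ neB)

  circuit-right : ∀ A₂ → Circuit D (∅ ++ A₂) ⇔ Circuit D₂ A₂
  circuit-right A₂ = mk⇔ to from
    where
    to : Circuit D (∅ ++ A₂) → Circuit D₂ A₂
    to (ne , dep , minimal) = ne₂ , Equivalence.to (right A₂) dep , minimal₂
      where
      ne₂ : Nonempty A₂
      ne₂ = Sum.[ (λ ne∅ → contradiction ne∅ ¬Nonempty-∅) , id ] (Nonempty-++⁻ ∅ A₂ ne)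
      minimal₂ : ∀ B → Nonempty B → B ⊆ A₂ → D₂ B → B ≡ A₂
      minimal₂ B neB B⊆A₂ dB =
        ++-injectiveʳ ∅ ∅ (minimal (∅ ++ B) (Nonempty-++ʳ ∅ neB) (⊆-++⁺ ⊆-refl B⊆A₂) (Equivalence.from (right B) dB))
    from : Circuit D₂ A₂ → Circuit D (∅ ++ A₂)
    from (ne₂ , d₂ , minimal₂) = Nonempty-++ʳ ∅ ne₂ , Equivalence.from (right A₂) d₂ , minimal
      where
      minimal : ∀ B → Nonempty B → B ⊆ ∅ ++ A₂ → D B → B ≡ ∅ ++ A₂
      minimal B neB B⊆ dB with Vec.splitAt n₁ B
      ... | B₁ , B₂ , refl with ⊆∅⇒≡∅ (⊆-++⁻ˡ {q = B₂} B⊆)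
      ... | refl = cong (∅ ++_) (minimal₂ B₂ neB₂ (⊆-++⁻ʳ {p = ∅} B⊆) (Equivalence.to (right B₂) dB))
        where
        neB₂ : Nonempty B₂
        neB₂ = Sum.[ (λ ne∅ → contradiction ne∅ ¬Nonempty-∅) , id ] (Nonempty-++⁻ ∅ B₂ neB)

  circuits : ∀ A → Circuit D A ⇔ DirectSumCircuit (Circuit D₁) (Circuit D₂) A
  circuits A with Vec.splitAt n₁ A
  ... | A₁ , A₂ , refl = mk⇔ to from
    where
    to : Circuit D (A₁ ++ A₂) → DirectSumCircuit (Circuit D₁) (Circuit D₂) (A₁ ++ A₂)
    to c with circuit-one-sided A₁ A₂ c
    ... | inj₂ refl = inj₁ (A₁ , Equivalence.to (circuit-left A₁) c , refl)
    ... | inj₁ refl = inj₂ (A₂ , Equivalence.to (circuit-right A₂) c , refl)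
    from : DirectSumCircuit (Circuit D₁) (Circuit D₂) (A₁ ++ A₂) → Circuit D (A₁ ++ A₂)
    from (inj₁ (C , c , eq)) with ++-injectiveˡ A₁ C eq | ++-injectiveʳ A₁ C eq
    ... | refl | refl = Equivalence.from (circuit-left C) c
    from (inj₂ (C , c , eq)) with ++-injectiveˡ A₁ ∅ eq | ++-injectiveʳ A₁ ∅ eq
    ... | refl | refl = Equivalence.from (circuit-right C) c

proposition5p1 : (G₁ G₂ : Graph) → Trivalent G₁ → Trivalent G₂ →
    TwoEdgeConnected G₁ → TwoEdgeConnected G₂ →
    (e₁ : Fin (nE G₁)) (a₁ b₁ : Fin (nV G₁)) → EdgeBetween G₁ e₁ a₁ b₁ →
    (e₂ : Fin (nE G₂)) (a₂ b₂ : Fin (nV G₂)) → EdgeBetween G₂ e₂ a₂ b₂ →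
    (A : Subset (nV G₁ + nV G₂)) →
    IsCircuit (glue G₁ G₂ e₁ e₂ a₁ b₁ a₂ b₂) A ⇔ DirectSumCircuit (IsCircuit G₁) (IsCircuit G₂) A
proposition5p1 G₁ G₂ _ _ tec₁ tec₂ e₁ a₁ b₁ eb₁ e₂ a₂ b₂ eb₂ =
  DirectSum.circuits (Dependent G) (Dependent G₁) (Dependent G₂) dependent-left dependent-right dependent-split
  where
  open Glue G₁ G₂ e₁ e₂ a₁ b₁ a₂ b₂ using (G)
  open Transfer G₁ G₂ tec₁ tec₂ e₁ a₁ b₁ eb₁ e₂ a₂ b₂ eb₂
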